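{- Let $h$ be a positive integer and let $0<\beta<1$ be a real. There is a positive real $\alpha$ depending on $h$ and $\beta$ such that the following is true. Let $G$ be any graph on $n$ vertices and let $p=\frac{2e(G)}{n^2}$. For any $i,j\in[h]$, let $\mathcal{A}_{i,j}$ denote the set of $i$-good sequences of length $j$ relative to $(\alpha,\beta,h,1)$ in $V(G)$. Then for all $i,j\in[h]$, \[ \sum_{S\in\mathcal{A}_{i,j}}|N(S)|\geq(1-\beta)\,n^{j+1}p^{j}. \] In particular, there exists an $i$-good sequence $S$ of length $j$ such that $|N(S)|\geq(1-\beta)p^j n$.
   Context: All graphs are finite simple graphs. A sequence in a set $W$ is a finite sequence of elements of $W$ (repetitions allowed); its length is its number of terms. For a sequence $S$ in $V(G)$, $N(S)$ is the set of vertices adjacent to every vertex of $S$; a sequence in $N(S)$ is a sequence all of whose terms lie in $N(S)$. Goodness relative to $(\alpha,\beta,h,1)$: for an $n$-vertex graph $G$ let $p=2e(G)/n^2$. A sequence $T$ in $V(G)$ is $0$-good if $|N(T)|\geq \alpha p^{|T|}n$. For $1\leq i\leq h$, a sequence $S$ in $V(G)$ of length at most $h$ is $i$-good if $S$ is $0$-good and, for each $|S|\leq k\leq h$, the number of $(i-1)$-good sequences of length $k$ in $N(S)$ is at least $(1-\beta)|N(S)|^k$.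
   Formalization: The parameter β ranges over the rationals rather than the reals, and the positive constant α is taken in the rationals as well. -}

module Defs where

open import Data.Bool using (Bool; true; false; _∧_; _∨_; not)
open import Data.Nat as ℕ using (ℕ; zero; suc)
open import Data.Fin using (Fin)
open import Data.List using (List; []; _∷_; length; filter; map; concatMap; upTo)
open import Data.Nat.ListAction using (sum)
open import Data.List.Base using (allFin)
open import Data.Integer using (+_)
open import Data.Rational using (ℚ; _/_; 0ℚ; 1ℚ; _*_; _-_; _≤ᵇ_)
open import Relation.Binary.PropositionalEquality using (_≡_)

record Graph (n : ℕ) : Set where
  field
    adj    : Fin n → Fin n → Bool
    sym    : ∀ u v → adj u v ≡ adj v u
    irrefl : ∀ u → adj u u ≡ false
open Graph public

ℕ→ℚ : ℕ → ℚ
ℕ→ℚ k = + k / 1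

_^ℚ_ : ℚ → ℕ → ℚ
x ^ℚ zero = 1ℚ
x ^ℚ suc k = x * (x ^ℚ k)

seqsOf : {A : Set} → ℕ → List A → List (List A)
seqsOf zero    L = [] ∷ []
seqsOf (suc k) L = concatMap (λ x → map (x ∷_) (seqsOf k L)) L

allB : {A : Set} → (A → Bool) → List A → Bool
allB P []       = true
allB P (x ∷ xs) = P x ∧ allB P xs

boolFilter : {A : Set} → (A → Bool) → List A → List A
boolFilter P [] = []
boolFilter P (x ∷ xs) with P x
... | true  = x ∷ boolFilter P xs
... | false = boolFilter P xs

count : {A : Set} → (A → Bool) → List A → ℕ
count P L = length (boolFilter P L)

ratioSq : ℕ → ℕ → ℚ
ratioSq a zero    = 0ℚ
ratioSq a (suc m) = + a / (suc m ℕ.* suc m)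

module _ {n : ℕ} (G : Graph n) where

  N : List (Fin n) → List (Fin n)
  N S = boolFilter (λ v → allB (adj G v) S) (allFin n)

  nb : List (Fin n) → ℕ
  nb S = length (N S)

  -- 2 e(G) = number of ordered adjacent pairs
  twoE : ℕ
  twoE = sum (map (λ u → count (adj G u) (allFin n)) (allFin n))

  -- p = 2 e(G) / n^2  (convention: p = 0 when n = 0)
  density : ℚ
  density = ratioSq twoE n

  module Goodness (α β : ℚ) (h : ℕ) where

    zeroGood : List (Fin n) → Bool
    zeroGood T = (α * (density ^ℚ length T)) * ℕ→ℚ n ≤ᵇ ℕ→ℚ (nb T)

    good : ℕ → List (Fin n) → Bool
    good zero    S = zeroGood S
    good (suc i) S =
      (length S ℕ.≤ᵇ h) ∧ zeroGood S ∧
      allB (λ k → not (length S ℕ.≤ᵇ k) ∨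
                 ((1ℚ - β) * (ℕ→ℚ (nb S) ^ℚ k) ≤ᵇ ℕ→ℚ (count (good i) (seqsOf k (N S)))))
          (upTo (suc h))

    A : ℕ → ℕ → List (List (Fin n))
    A i j = boolFilter (good i) (seqsOf j (allFin n))

    sumNb : ℕ → ℕ → ℕ
    sumNb i j = sum (map nb (A i j))

{-# OPTIONS --safe #-}
module Submission where

-- Write x T = |N(T)| and s k = p^k n, the neighbourhood size of a length-k sequence in a
-- random graph of density p, and let Bad i k m be the m-th moment of x over the length-k
-- sequences that are not i-good. A sequence that is not 0-good has x < α s k, so
-- Bad 0 k m ≤ α n^k s_k^m. If T of length k violates the (i+1)-requirement at length
-- k′ = m + d, then a β-fraction of the k′-sequences U ⊆ N(T) are not i-good; with
-- t = δ s k the inequality t^d x^m ≤ t^k′ + x^k′ charges x_T^m to these pairs (T, U), and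
-- double counting (T ⊆ N(U) iff U ⊆ N(T)) bounds their number by Bad i k′ k. Iterating h
-- times with rapidly shrinking error parameters gives Bad i j 1 ≤ β n^(j+1) p^j, while
-- Σ_T x T = Σ_v deg(v)^j ≥ n^(j+1) p^j by the power-mean inequality; what is left is
-- carried by the i-good sequences, and one of them is at least average.

open import Algebra.Bundles using (CommutativeSemiring)
import Data.Nat
import Data.Rational
import Defs

module FiniteSum {c ℓ} (R : CommutativeSemiring c ℓ) where
  open import Data.Bool using (Bool; true; false; _∧_; if_then_else_)
  open import Data.List using (List; []; _∷_; _++_; map; concatMap)
  open import Defs using (seqsOf; allB; boolFilter)
  open import Data.Nat using (zero; suc)
  open CommutativeSemiring R
  open import Relation.Binary.Reasoning.Setoid setoid
  open import Algebra.Properties.CommutativeSemigroup +-commutativeSemigroup using (interchange)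

  private variable A B : Set

  Σ : (A → Carrier) → List A → Carrier
  Σ f []       = 0#
  Σ f (x ∷ xs) = f x + Σ f xs

  keepIf : Bool → Carrier → Carrier
  keepIf b r = if b then r else 0#

  Σ-cong : ∀ {f g : A → Carrier} L → (∀ x → f x ≈ g x) → Σ f L ≈ Σ g L
  Σ-cong []      f≈g = refl
  Σ-cong (x ∷ L) f≈g = +-cong (f≈g x) (Σ-cong L f≈g)

  Σ-++ : ∀ (f : A → Carrier) xs ys → Σ f (xs ++ ys) ≈ Σ f xs + Σ f ys
  Σ-++ f []       ys = sym (+-identityˡ _)
  Σ-++ f (x ∷ xs) ys = trans (+-congˡ (Σ-++ f xs ys)) (sym (+-assoc (f x) _ _))

  Σ-concatMap : ∀ (f : B → Carrier) (g : A → List B) L →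
    Σ f (concatMap g L) ≈ Σ (λ x → Σ f (g x)) L
  Σ-concatMap f g []      = refl
  Σ-concatMap f g (x ∷ L) = trans (Σ-++ f (g x) _) (+-congˡ (Σ-concatMap f g L))

  Σ-map : ∀ (f : B → Carrier) (g : A → B) L → Σ f (map g L) ≈ Σ (λ x → f (g x)) L
  Σ-map f g []      = refl
  Σ-map f g (x ∷ L) = +-congˡ (Σ-map f g L)

  Σ-zero : ∀ (L : List A) → Σ (λ _ → 0#) L ≈ 0#
  Σ-zero []      = refl
  Σ-zero (x ∷ L) = trans (+-identityˡ _) (Σ-zero L)

  Σ-+ : ∀ (f g : A → Carrier) L → Σ (λ x → f x + g x) L ≈ Σ f L + Σ g L
  Σ-+ f g []      = sym (+-identityˡ 0#)
  Σ-+ f g (x ∷ L) = trans (+-congˡ (Σ-+ f g L)) (interchange (f x) (g x) (Σ f L) (Σ g L))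

  Σ-*ˡ : ∀ r (f : A → Carrier) L → Σ (λ x → r * f x) L ≈ r * Σ f L
  Σ-*ˡ r f []      = sym (zeroʳ r)
  Σ-*ˡ r f (x ∷ L) = trans (+-congˡ (Σ-*ˡ r f L)) (sym (distribˡ r (f x) _))

  Σ-comm : ∀ (f : A → B → Carrier) L M →
    Σ (λ x → Σ (f x) M) L ≈ Σ (λ y → Σ (λ x → f x y) L) M
  Σ-comm f []      M = sym (Σ-zero M)
  Σ-comm f (x ∷ L) M = trans (+-congˡ (Σ-comm f L M)) (sym (Σ-+ (f x) _ M))

  Σ-boolFilter : ∀ (f : A → Carrier) (P : A → Bool) L →
    Σ f (boolFilter P L) ≈ Σ (λ x → keepIf (P x) (f x)) L
  Σ-boolFilter f P []      = refl
  Σ-boolFilter f P (x ∷ L) with P x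
  ... | true  = +-congˡ (Σ-boolFilter f P L)
  ... | false = trans (Σ-boolFilter f P L) (sym (+-identityˡ _))

  keepIf-∧ : ∀ a b r → keepIf (a ∧ b) r ≈ keepIf a (keepIf b r)
  keepIf-∧ true  b r = refl
  keepIf-∧ false b r = refl

  keepIf-Σ : ∀ b (f : A → Carrier) L → keepIf b (Σ f L) ≈ Σ (λ x → keepIf b (f x)) L
  keepIf-Σ true  f L = refl
  keepIf-Σ false f L = sym (Σ-zero L)

  keepIf-* : ∀ b r → keepIf b r ≈ keepIf b 1# * r
  keepIf-* true  r = sym (*-identityˡ r)
  keepIf-* false r = sym (zeroˡ r)

  keepIf-comm : ∀ a b r → keepIf a (keepIf b r) ≈ keepIf b (keepIf a r)
  keepIf-comm true  b r = refl
  keepIf-comm false true  r = refl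
  keepIf-comm false false r = refl

  Σ-seqsOf-suc : ∀ (g : List A → Carrier) k L →
    Σ g (seqsOf (suc k) L) ≈ Σ (λ x → Σ (λ U → g (x ∷ U)) (seqsOf k L)) L
  Σ-seqsOf-suc g k L = trans (Σ-concatMap g (λ x → map (x ∷_) (seqsOf k L)) L)
                             (Σ-cong L (λ x → Σ-map g (x ∷_) (seqsOf k L)))

  Σ-seqsOf-boolFilter : ∀ (g : List A → Carrier) (P : A → Bool) k L →
    Σ g (seqsOf k (boolFilter P L)) ≈ Σ (λ U → keepIf (allB P U) (g U)) (seqsOf k L)
  Σ-seqsOf-boolFilter g P zero    L = refl
  Σ-seqsOf-boolFilter g P (suc k) L = begin
      Σ g (seqsOf (suc k) (boolFilter P L))
    ≈⟨ Σ-seqsOf-suc g k (boolFilter P L) ⟩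
      Σ (λ x → Σ (λ U → g (x ∷ U)) (seqsOf k (boolFilter P L))) (boolFilter P L)
    ≈⟨ Σ-boolFilter _ P L ⟩
      Σ (λ x → keepIf (P x) (Σ (λ U → g (x ∷ U)) (seqsOf k (boolFilter P L)))) L
    ≈⟨ Σ-cong L (λ x → keepIf-cong (P x) (Σ-seqsOf-boolFilter (λ U → g (x ∷ U)) P k L)) ⟩
      Σ (λ x → keepIf (P x) (Σ (λ U → keepIf (allB P U) (g (x ∷ U))) (seqsOf k L))) L
    ≈⟨ Σ-cong L (λ x → trans (keepIf-Σ (P x) _ (seqsOf k L))
                             (Σ-cong (seqsOf k L) (λ U → sym (keepIf-∧ (P x) (allB P U) _)))) ⟩
      Σ (λ x → Σ (λ U → keepIf (allB P (x ∷ U)) (g (x ∷ U))) (seqsOf k L)) L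
    ≈⟨ Σ-seqsOf-suc (λ U → keepIf (allB P U) (g U)) k L ⟨
      Σ (λ U → keepIf (allB P U) (g U)) (seqsOf (suc k) L)
    ∎
    where
    keepIf-cong : ∀ b {r s} → r ≈ s → keepIf b r ≈ keepIf b s
    keepIf-cong true  r≈s = r≈s
    keepIf-cong false _   = refl

module Counting where
  open import Data.Nat
  open import Data.Nat.Properties
  open import Data.Nat.ListAction using (sum)
  open import Data.Bool using (Bool; T; true; false; _∧_; _∨_; not)
  open import Data.Bool.Properties using (T-≡)
  open import Data.Unit using (tt)
  open import Data.List using (List; []; _∷_; length; map; concatMap; replicate)
  open import Data.List.Membership.Propositional using (_∈_)
  open import Data.List.Membership.Propositional.Properties using (∈-++⁻; ∈-map⁻; ∈-map⁺; ∈-concat⁺′)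
  open import Data.List.Relation.Unary.Any using (here; there)
  open import Data.Product using (_,_)
  open import Data.Sum using (inj₁; inj₂)
  open import Function.Bundles using (Equivalence)
  open import Relation.Binary.PropositionalEquality
  open import Relation.Nullary using (contradiction)
  open import Defs using (seqsOf; allB; boolFilter; count)
  open FiniteSum +-*-commutativeSemiring public

  private variable A : Set

  ≤⇒≤ᵇ≡true : ∀ {a b} → a ≤ b → (a ≤ᵇ b) ≡ true
  ≤⇒≤ᵇ≡true a≤b = Equivalence.to T-≡ (≤⇒≤ᵇ a≤b)

  >⇒≤ᵇ≡false : ∀ {a b} → b < a → (a ≤ᵇ b) ≡ false
  >⇒≤ᵇ≡false {a} {b} b<a with a ≤ᵇ b in a≤ᵇb
  ... | true  = contradiction (≤ᵇ⇒≤ a b (subst T (sym a≤ᵇb) tt)) (<⇒≱ b<a)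
  ... | false = refl

  ∨≡false⇒≡false : ∀ a {b} → a ∨ b ≡ false → b ≡ false
  ∨≡false⇒≡false false b≡false = b≡false

  Σ-mono-≤ : ∀ {f g : A → ℕ} L → (∀ x → f x ≤ g x) → Σ f L ≤ Σ g L
  Σ-mono-≤ []      f≤g = z≤n
  Σ-mono-≤ (x ∷ L) f≤g = +-mono-≤ (f≤g x) (Σ-mono-≤ L f≤g)

  Σ-const : ∀ r (L : List A) → Σ (λ _ → r) L ≡ length L * r
  Σ-const r []      = refl
  Σ-const r (x ∷ L) = cong (r +_) (Σ-const r L)

  sum-map : ∀ (f : A → ℕ) L → sum (map f L) ≡ Σ f L
  sum-map f []      = refl
  sum-map f (x ∷ L) = cong (f x +_) (sum-map f L)

  Σ≡0⇒≡0 : ∀ (f : A → ℕ) {L x} → Σ f L ≡ 0 → x ∈ L → f x ≡ 0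
  Σ≡0⇒≡0 f {y ∷ L} Σ≡0 (here refl) = m+n≡0⇒m≡0 (f y) Σ≡0
  Σ≡0⇒≡0 f {y ∷ L} Σ≡0 (there x∈L) = Σ≡0⇒≡0 f (m+n≡0⇒n≡0 (f y) Σ≡0) x∈L

  allB-true : ∀ {P : A → Bool} L → (∀ x → P x ≡ true) → allB P L ≡ true
  allB-true []      P≡true = refl
  allB-true (x ∷ L) P≡true = cong₂ _∧_ (P≡true x) (allB-true L P≡true)

  allB-cong : ∀ {P Q : A → Bool} L → (∀ x → P x ≡ Q x) → allB P L ≡ allB Q L
  allB-cong []      P≡Q = refl
  allB-cong (x ∷ L) P≡Q = cong₂ _∧_ (P≡Q x) (allB-cong L P≡Q)

  allB-∧ : ∀ (P Q : A → Bool) L → allB (λ x → P x ∧ Q x) L ≡ allB P L ∧ allB Q L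
  allB-∧ P Q []      = refl
  allB-∧ P Q (x ∷ L) = trans (cong ((P x ∧ Q x) ∧_) (allB-∧ P Q L)) (∧-interchange (P x) (Q x) (allB P L) (allB Q L))
    where
    open import Algebra.Bundles using (CommutativeMonoid)
    open import Data.Bool.Properties using (∧-commutativeMonoid)
    open import Algebra.Properties.CommutativeSemigroup (CommutativeMonoid.commutativeSemigroup ∧-commutativeMonoid)
      using () renaming (interchange to ∧-interchange)

  allB-comm : ∀ {B : Set} (R : A → B → Bool) T U →
    allB (λ u → allB (R u) T) U ≡ allB (λ t → allB (λ u → R u t) U) T
  allB-comm R T []      = sym (allB-true T (λ _ → refl))
  allB-comm R T (u ∷ U) = trans (cong (allB (R u) T ∧_) (allB-comm R T U)) (sym (allB-∧ (R u) _ T))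

  count-≡-Σ : ∀ (P : A → Bool) L → count P L ≡ Σ (λ x → keepIf (P x) 1) L
  count-≡-Σ P []      = refl
  count-≡-Σ P (x ∷ L) with P x
  ... | true  = cong suc (count-≡-Σ P L)
  ... | false = count-≡-Σ P L

  count-cong : ∀ {P Q : A → Bool} L → (∀ x → P x ≡ Q x) → count P L ≡ count Q L
  count-cong {P = P} {Q} L P≡Q = begin
    count P L                       ≡⟨ count-≡-Σ P L ⟩
    Σ (λ x → keepIf (P x) 1) L      ≡⟨ Σ-cong L (λ x → cong (λ b → keepIf b 1) (P≡Q x)) ⟩
    Σ (λ x → keepIf (Q x) 1) L      ≡⟨ count-≡-Σ Q L ⟨
    count Q L                       ∎
    where open ≡-Reasoning

  count-≤-length : ∀ (P : A → Bool) L → count P L ≤ length L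
  count-≤-length P []      = z≤n
  count-≤-length P (x ∷ L) with P x
  ... | true  = s≤s (count-≤-length P L)
  ... | false = m≤n⇒m≤1+n (count-≤-length P L)

  count-+-count-not : ∀ (P : A → Bool) L → count P L + count (λ x → not (P x)) L ≡ length L
  count-+-count-not P []      = refl
  count-+-count-not P (x ∷ L) with P x
  ... | true  = cong suc (count-+-count-not P L)
  ... | false = trans (+-suc _ _) (cong suc (count-+-count-not P L))

  count≡0⇒false : ∀ (P : A → Bool) {L x} → count P L ≡ 0 → x ∈ L → P x ≡ false
  count≡0⇒false P {y ∷ L} count≡0 x∈ with P y in Py
  count≡0⇒false P {y ∷ L} count≡0 (here refl)  | false = Py
  count≡0⇒false P {y ∷ L} count≡0 (there x∈L) | false = count≡0⇒false P count≡0 x∈L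

  false⇒count≡0 : ∀ (P : A → Bool) L → (∀ x → P x ≡ false) → count P L ≡ 0
  false⇒count≡0 P []      _ = refl
  false⇒count≡0 P (x ∷ L) P≡false rewrite P≡false x = false⇒count≡0 P L P≡false

  ∈-boolFilter : ∀ (P : A → Bool) {x L} → x ∈ L → P x ≡ true → x ∈ boolFilter P L
  ∈-boolFilter P {L = y ∷ L} (here refl) Px with P y
  ∈-boolFilter P {L = y ∷ L} (here refl) refl | true = here refl
  ∈-boolFilter P {L = y ∷ L} (there x∈L) Px with P y
  ... | true  = there (∈-boolFilter P x∈L Px)
  ... | false = ∈-boolFilter P x∈L Px

  count-seqsOf-allB : ∀ (P : A → Bool) k L → count (allB P) (seqsOf k L) ≡ count P L ^ k
  count-seqsOf-allB P zero    L = refl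
  count-seqsOf-allB P (suc k) L = begin
      count (allB P) (seqsOf (suc k) L)
    ≡⟨ count-≡-Σ (allB P) (seqsOf (suc k) L) ⟩
      Σ (λ U → keepIf (allB P U) 1) (seqsOf (suc k) L)
    ≡⟨ Σ-seqsOf-suc _ k L ⟩
      Σ (λ x → Σ (λ U → keepIf (P x ∧ allB P U) 1) (seqsOf k L)) L
    ≡⟨ Σ-cong L (λ x → trans (Σ-cong (seqsOf k L) (λ U → trans (keepIf-∧ (P x) (allB P U) 1)
                                                              (keepIf-* (P x) _)))
                             (Σ-*ˡ (keepIf (P x) 1) _ (seqsOf k L))) ⟩
      Σ (λ x → keepIf (P x) 1 * Σ (λ U → keepIf (allB P U) 1) (seqsOf k L)) L
    ≡⟨ Σ-cong L (λ x → cong (keepIf (P x) 1 *_) (sym (count-≡-Σ (allB P) (seqsOf k L)))) ⟩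
      Σ (λ x → keepIf (P x) 1 * count (allB P) (seqsOf k L)) L
    ≡⟨ Σ-cong L (λ x → *-comm (keepIf (P x) 1) _) ⟩
      Σ (λ x → count (allB P) (seqsOf k L) * keepIf (P x) 1) L
    ≡⟨ Σ-*ˡ (count (allB P) (seqsOf k L)) _ L ⟩
      count (allB P) (seqsOf k L) * Σ (λ x → keepIf (P x) 1) L
    ≡⟨ cong₂ _*_ (count-seqsOf-allB P k L) (sym (count-≡-Σ P L)) ⟩
      count P L ^ k * count P L
    ≡⟨ *-comm _ (count P L) ⟩
      count P L ^ suc k
    ∎
    where open ≡-Reasoning

  length-seqsOf : ∀ k (L : List A) → length (seqsOf k L) ≡ length L ^ k
  length-seqsOf k L = begin
    length (seqsOf k L)                      ≡⟨ count-true (seqsOf k L) ⟨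
    count (λ _ → true) (seqsOf k L)          ≡⟨ count-cong (seqsOf k L) (λ U → sym (allB-true U (λ _ → refl))) ⟩
    count (allB (λ _ → true)) (seqsOf k L)   ≡⟨ count-seqsOf-allB (λ _ → true) k L ⟩
    count (λ _ → true) L ^ k                 ≡⟨ cong (_^ k) (count-true L) ⟩
    length L ^ k                             ∎
    where
    open ≡-Reasoning
    count-true : ∀ (L : List A) → count (λ _ → true) L ≡ length L
    count-true []      = refl
    count-true (x ∷ L) = cong suc (count-true L)

  ∈-seqsOf⇒length : ∀ k (L : List A) {U} → U ∈ seqsOf k L → length U ≡ k
  ∈-seqsOf⇒length zero    L (here refl) = refl
  ∈-seqsOf⇒length (suc k) L {U} U∈ = go L U∈
    where
    go : ∀ M → U ∈ concatMap (λ x → map (x ∷_) (seqsOf k L)) M → length U ≡ suc k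
    go (z ∷ M) U∈ with ∈-++⁻ (map (z ∷_) (seqsOf k L)) U∈
    ... | inj₂ U∈′ = go M U∈′
    ... | inj₁ U∈′ with ∈-map⁻ (z ∷_) U∈′
    ...   | V , V∈ , refl = cong suc (∈-seqsOf⇒length k L V∈)

  replicate-∈-seqsOf : ∀ k {v : A} {L} → v ∈ L → replicate k v ∈ seqsOf k L
  replicate-∈-seqsOf zero    v∈L = here refl
  replicate-∈-seqsOf (suc k) {v} {L} v∈L =
    ∈-concat⁺′ (∈-map⁺ (v ∷_) (replicate-∈-seqsOf k v∈L)) (∈-map⁺ (λ x → map (x ∷_) (seqsOf k L)) v∈L)

module PowerMean where
  open import Data.Nat
  open import Data.Nat.Properties
  open import Data.List using (List; length)
  open import Data.Product using (_,_)
  open import Data.Sum using (inj₁; inj₂)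
  open import Relation.Binary.PropositionalEquality
  open import Data.Nat.Solver using (module +-*-Solver)
  open +-*-Solver using (solve; _:=_; _:+_; _:*_; con)
  open Counting

  private variable A : Set

  rearrangement : ∀ {a b c d} → a ≤ b → c ≤ d → a * d + b * c ≤ a * c + b * d
  rearrangement {a} {b} {c} {d} a≤b c≤d with m≤n⇒∃[o]m+o≡n a≤b | m≤n⇒∃[o]m+o≡n c≤d
  ... | u , refl | w , refl = subst₂ _≤_ (sym lhs) (sym rhs) (m≤m+n _ (u * w))
    where
    lhs : a * (c + w) + (a + u) * c ≡ a * c + a * c + a * w + u * c
    lhs = solve 4 (λ a c u w → a :* (c :+ w) :+ (a :+ u) :* c := a :* c :+ a :* c :+ a :* w :+ u :* c)
                  refl a c u w
    rhs : a * c + (a + u) * (c + w) ≡ a * c + a * c + a * w + u * c + u * w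
    rhs = solve 4 (λ a c u w → a :* c :+ (a :+ u) :* (c :+ w) := a :* c :+ a :* c :+ a :* w :+ u :* c :+ u :* w)
                  refl a c u w

  a*bᵏ+aᵏ*b≤aᵏ⁺¹+bᵏ⁺¹ : ∀ a b k → a * b ^ k + a ^ k * b ≤ a ^ suc k + b ^ suc k
  a*bᵏ+aᵏ*b≤aᵏ⁺¹+bᵏ⁺¹ a b k with ≤-total a b
  ... | inj₁ a≤b = subst (_≤ a ^ suc k + b ^ suc k) (cong (a * b ^ k +_) (*-comm b (a ^ k)))
                     (rearrangement a≤b (^-monoˡ-≤ k a≤b))
  ... | inj₂ b≤a = subst₂ _≤_ (trans (+-comm (b * a ^ k) _) (cong (a * b ^ k +_) (*-comm b (a ^ k))))
                              (+-comm (b ^ suc k) _)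
                     (rearrangement b≤a (^-monoˡ-≤ k b≤a))

  module _ (d : A → ℕ) (L : List A) where
    private
      moment : ℕ → ℕ
      moment t = Σ (λ x → d x ^ t) L

      Σ-*-Σ : ∀ (f g : A → ℕ) → Σ f L * Σ g L ≡ Σ (λ x → Σ (λ y → f x * g y) L) L
      Σ-*-Σ f g = trans (*-comm (Σ f L) _) (trans (sym (Σ-*ˡ (Σ g L) f L))
                   (Σ-cong L (λ x → trans (*-comm (Σ g L) (f x)) (sym (Σ-*ˡ (f x) g L)))))

    chebyshev : ∀ k → Σ d L * moment k ≤ length L * moment (suc k)
    chebyshev k = *-cancelˡ-≤ 2 (begin
        2 * (Σ d L * moment k)
      ≡⟨ solve 2 (λ a b → con 2 :* (a :* b) := a :* b :+ b :* a) refl (Σ d L) (moment k) ⟩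
        Σ d L * moment k + moment k * Σ d L
      ≡⟨ cong₂ _+_ (Σ-*-Σ d (λ x → d x ^ k)) (Σ-*-Σ (λ x → d x ^ k) d) ⟩
        Σ (λ x → Σ (λ y → d x * d y ^ k) L) L + Σ (λ x → Σ (λ y → d x ^ k * d y) L) L
      ≡⟨ trans (sym (Σ-+ _ _ L)) (Σ-cong L (λ x → sym (Σ-+ _ _ L))) ⟩
        Σ (λ x → Σ (λ y → d x * d y ^ k + d x ^ k * d y) L) L
      ≤⟨ Σ-mono-≤ L (λ x → Σ-mono-≤ L (λ y → a*bᵏ+aᵏ*b≤aᵏ⁺¹+bᵏ⁺¹ (d x) (d y) k)) ⟩
        Σ (λ x → Σ (λ y → d x ^ suc k + d y ^ suc k) L) L
      ≡⟨ Σ-cong L (λ x → trans (Σ-+ _ _ L) (cong (_+ moment (suc k)) (Σ-const (d x ^ suc k) L))) ⟩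
        Σ (λ x → length L * d x ^ suc k + moment (suc k)) L
      ≡⟨ Σ-+ _ _ L ⟩
        Σ (λ x → length L * d x ^ suc k) L + Σ (λ _ → moment (suc k)) L
      ≡⟨ cong₂ _+_ (Σ-*ˡ (length L) (λ x → d x ^ suc k) L) (Σ-const (moment (suc k)) L) ⟩
        length L * moment (suc k) + length L * moment (suc k)
      ≡⟨ solve 1 (λ a → a :+ a := con 2 :* a) refl (length L * moment (suc k)) ⟩
        2 * (length L * moment (suc k))
      ∎)
      where open ≤-Reasoning

    power-mean : ∀ k → Σ d L ^ suc k ≤ length L ^ k * Σ (λ x → d x ^ suc k) L
    power-mean zero = ≤-reflexive (trans (*-identityʳ _)
      (sym (trans (+-identityʳ _) (Σ-cong L (λ x → *-identityʳ (d x))))))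
    power-mean (suc k) = begin
        Σ d L * Σ d L ^ suc k
      ≤⟨ *-monoʳ-≤ (Σ d L) (power-mean k) ⟩
        Σ d L * (length L ^ k * moment (suc k))
      ≡⟨ solve 3 (λ a b c → a :* (b :* c) := b :* (a :* c)) refl (Σ d L) (length L ^ k) (moment (suc k)) ⟩
        length L ^ k * (Σ d L * moment (suc k))
      ≤⟨ *-monoʳ-≤ (length L ^ k) (chebyshev (suc k)) ⟩
        length L ^ k * (length L * moment (suc (suc k)))
      ≡⟨ solve 3 (λ a b c → a :* (b :* c) := (b :* a) :* c) refl (length L ^ k) (length L) (moment (suc (suc k))) ⟩
        length L ^ suc k * moment (suc (suc k))
      ∎
      where open ≤-Reasoning

module Rationals where
  open import Data.Nat as ℕ using (ℕ; zero; suc)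
  import Data.Nat.Properties as ℕP
  open import Data.Nat.Coprimality as Coprimality using ()
  open import Data.Integer as ℤ using (+_)
  import Data.Integer.Properties as ℤP
  open import Data.Rational
  open import Data.Rational.Properties
  import Data.Rational.Unnormalised as ℚᵘ
  import Data.Rational.Unnormalised.Properties as ℚᵘP
  open import Data.Product using (_,_)
  open import Data.Sum using (inj₁; inj₂)
  open import Relation.Binary.PropositionalEquality
  open import Data.Bool using (T; true; false)
  open import Data.Bool.Properties using (T-≡)
  open import Function.Bundles using (Equivalence)
  open import Data.Rational.Solver using (module +-*-Solver)
  open +-*-Solver using (solve; _:=_; _:+_; _:*_; _:-_; con)
  open import Defs using (ℕ→ℚ; _^ℚ_; ratioSq)

  private
    ℕ→ℚ≡mkℚ : ∀ a → ℕ→ℚ a ≡ mkℚ (+ a) 0 (Coprimality.sym (Coprimality.1-coprimeTo a))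
    ℕ→ℚ≡mkℚ a = normalize-coprime (Coprimality.sym (Coprimality.1-coprimeTo a))

    ℕ→ℚ-toℚᵘ : ∀ a → toℚᵘ (ℕ→ℚ a) ≡ ℚᵘ.mkℚᵘ (+ a) 0
    ℕ→ℚ-toℚᵘ a = cong toℚᵘ (ℕ→ℚ≡mkℚ a)

    ℕ→ℚ-via-ℚᵘ : ∀ a {q} → ℚᵘ.mkℚᵘ (+ a) 0 ℚᵘ.≃ toℚᵘ q → ℕ→ℚ a ≡ q
    ℕ→ℚ-via-ℚᵘ a eq = toℚᵘ-injective (ℚᵘP.≃-trans (ℚᵘP.≃-reflexive (ℕ→ℚ-toℚᵘ a)) eq)

  ℕ→ℚ-homo-+ : ∀ a b → ℕ→ℚ (a ℕ.+ b) ≡ ℕ→ℚ a + ℕ→ℚ b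
  ℕ→ℚ-homo-+ a b = ℕ→ℚ-via-ℚᵘ (a ℕ.+ b) (ℚᵘP.≃-trans (ℚᵘ.*≡* integers)
    (ℚᵘP.≃-sym (ℚᵘP.≃-trans (toℚᵘ-homo-+ (ℕ→ℚ a) (ℕ→ℚ b))
                            (ℚᵘP.≃-reflexive (cong₂ ℚᵘ._+_ (ℕ→ℚ-toℚᵘ a) (ℕ→ℚ-toℚᵘ b))))))
    where
    integers : + (a ℕ.+ b) ℤ.* + 1 ≡ (+ a ℤ.* + 1 ℤ.+ + b ℤ.* + 1) ℤ.* + 1
    integers = trans (ℤP.*-identityʳ _) (trans (ℤP.pos-+ a b)
                 (sym (trans (ℤP.*-identityʳ _) (cong₂ ℤ._+_ (ℤP.*-identityʳ (+ a)) (ℤP.*-identityʳ (+ b))))))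

  ℕ→ℚ-homo-* : ∀ a b → ℕ→ℚ (a ℕ.* b) ≡ ℕ→ℚ a * ℕ→ℚ b
  ℕ→ℚ-homo-* a b = ℕ→ℚ-via-ℚᵘ (a ℕ.* b) (ℚᵘP.≃-trans (ℚᵘ.*≡* integers)
    (ℚᵘP.≃-sym (ℚᵘP.≃-trans (toℚᵘ-homo-* (ℕ→ℚ a) (ℕ→ℚ b))
                            (ℚᵘP.≃-reflexive (cong₂ ℚᵘ._*_ (ℕ→ℚ-toℚᵘ a) (ℕ→ℚ-toℚᵘ b))))))
    where
    integers : + (a ℕ.* b) ℤ.* + 1 ≡ (+ a ℤ.* + b) ℤ.* + 1
    integers = trans (ℤP.*-identityʳ _) (trans (ℤP.pos-* a b) (sym (ℤP.*-identityʳ _)))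

  ℕ→ℚ-homo-^ : ∀ a k → ℕ→ℚ (a ℕ.^ k) ≡ ℕ→ℚ a ^ℚ k
  ℕ→ℚ-homo-^ a zero    = refl
  ℕ→ℚ-homo-^ a (suc k) = trans (ℕ→ℚ-homo-* a (a ℕ.^ k)) (cong (ℕ→ℚ a *_) (ℕ→ℚ-homo-^ a k))

  private
    /suc-*-ℕ→ℚ : ∀ a d → (+ a / suc d) * ℕ→ℚ (suc d) ≡ ℕ→ℚ a
    /suc-*-ℕ→ℚ a d = sym (ℕ→ℚ-via-ℚᵘ a (ℚᵘP.≃-sym (ℚᵘP.≃-trans (toℚᵘ-homo-* (+ a / suc d) (ℕ→ℚ (suc d)))
      (ℚᵘP.≃-trans (ℚᵘP.*-cong (toℚᵘ-fromℚᵘ (ℚᵘ.mkℚᵘ (+ a) d)) (ℚᵘP.≃-reflexive (ℕ→ℚ-toℚᵘ (suc d))))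
                   (ℚᵘ.*≡* (ℤP.*-assoc (+ a) (+ suc d) (+ 1)))))))

  ℕ→ℚ-nonNeg : ∀ a → 0ℚ ≤ ℕ→ℚ a
  ℕ→ℚ-nonNeg a rewrite ℕ→ℚ≡mkℚ a = nonNegative⁻¹ _

  ℕ→ℚ-pos : ∀ {a} → 1 ℕ.≤ a → 0ℚ < ℕ→ℚ a
  ℕ→ℚ-pos {suc a} _ rewrite ℕ→ℚ≡mkℚ (suc a) = positive⁻¹ _

  ℕ→ℚ-mono-≤ : ∀ {a b} → a ℕ.≤ b → ℕ→ℚ a ≤ ℕ→ℚ b
  ℕ→ℚ-mono-≤ {a} a≤b with ℕP.m≤n⇒∃[o]m+o≡n a≤b
  ... | c , refl = begin
    ℕ→ℚ a            ≡⟨ +-identityʳ (ℕ→ℚ a) ⟨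
    ℕ→ℚ a + 0ℚ       ≤⟨ +-monoʳ-≤ (ℕ→ℚ a) (ℕ→ℚ-nonNeg c) ⟩
    ℕ→ℚ a + ℕ→ℚ c    ≡⟨ ℕ→ℚ-homo-+ a c ⟨
    ℕ→ℚ (a ℕ.+ c)    ∎
    where open ≤-Reasoning

  ratioSq-nonNeg : ∀ a m → 0ℚ ≤ ratioSq a m
  ratioSq-nonNeg a zero    = ≤-refl
  ratioSq-nonNeg a (suc m) = nonNegative⁻¹ _ {{normalize-nonNeg a (suc m ℕ.* suc m)}}

  ratioSq-pos : ∀ {a m} → 1 ℕ.≤ a → 1 ℕ.≤ m → 0ℚ < ratioSq a m
  ratioSq-pos {a} {suc m} 1≤a _ = positive⁻¹ _ {{normalize-pos a (suc m ℕ.* suc m) {{_}} {{ℕ.>-nonZero 1≤a}}}}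

  ratioSq-zero : ∀ m → ratioSq 0 m ≡ 0ℚ
  ratioSq-zero zero    = refl
  ratioSq-zero (suc m) = toℚᵘ-injective (ℚᵘP.≃-trans (toℚᵘ-fromℚᵘ (ℚᵘ.mkℚᵘ (+ 0) (m ℕ.+ m ℕ.* suc m))) (ℚᵘ.*≡* refl))

  ratioSq-*-sq : ∀ a {m} → 1 ℕ.≤ m → ratioSq a m * (ℕ→ℚ m * ℕ→ℚ m) ≡ ℕ→ℚ a
  ratioSq-*-sq a {suc m} _ = trans (cong (ratioSq a (suc m) *_) (sym (ℕ→ℚ-homo-* (suc m) (suc m))))
                                   (/suc-*-ℕ→ℚ a (m ℕ.+ m ℕ.* suc m))

  *-nonNeg : ∀ {a b} → 0ℚ ≤ a → 0ℚ ≤ b → 0ℚ ≤ a * b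
  *-nonNeg {a} {b} 0≤a 0≤b = nonNegative⁻¹ _ {{nonNeg*nonNeg⇒nonNeg a {{nonNegative 0≤a}} b {{nonNegative 0≤b}}}}

  *-pos : ∀ {a b} → 0ℚ < a → 0ℚ < b → 0ℚ < a * b
  *-pos {a} {b} 0<a 0<b = positive⁻¹ _ {{pos*pos⇒pos a {{positive 0<a}} b {{positive 0<b}}}}

  *-monoˡ-≤-0≤ : ∀ {r a b} → 0ℚ ≤ r → a ≤ b → r * a ≤ r * b
  *-monoˡ-≤-0≤ {r} 0≤r = *-monoˡ-≤-nonNeg r {{nonNegative 0≤r}}

  *-monoʳ-≤-0≤ : ∀ {r a b} → 0ℚ ≤ r → a ≤ b → a * r ≤ b * r
  *-monoʳ-≤-0≤ {r} 0≤r = *-monoʳ-≤-nonNeg r {{nonNegative 0≤r}}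

  *-mono-≤-0≤ : ∀ {a b c d} → 0ℚ ≤ a → 0ℚ ≤ c → a ≤ b → c ≤ d → a * c ≤ b * d
  *-mono-≤-0≤ 0≤a 0≤c a≤b c≤d = ≤-trans (*-monoʳ-≤-0≤ 0≤c a≤b) (*-monoˡ-≤-0≤ (≤-trans 0≤a a≤b) c≤d)

  *-cancelˡ-≤-0< : ∀ {r a b} → 0ℚ < r → r * a ≤ r * b → a ≤ b
  *-cancelˡ-≤-0< {r} 0<r = *-cancelˡ-≤-pos r {{positive 0<r}}

  p≤p+q : ∀ {p q} → 0ℚ ≤ q → p ≤ p + q
  p≤p+q {p} 0≤q = ≤-trans (≤-reflexive (sym (+-identityʳ p))) (+-monoʳ-≤ p 0≤q)

  p≤q+p : ∀ {p q} → 0ℚ ≤ q → p ≤ q + p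
  p≤q+p {p} 0≤q = ≤-trans (≤-reflexive (sym (+-identityˡ p))) (+-monoˡ-≤ p 0≤q)

  ^ℚ-distribˡ-+-* : ∀ x a b → x ^ℚ (a ℕ.+ b) ≡ x ^ℚ a * x ^ℚ b
  ^ℚ-distribˡ-+-* x zero    b = sym (*-identityˡ _)
  ^ℚ-distribˡ-+-* x (suc a) b = trans (cong (x *_) (^ℚ-distribˡ-+-* x a b)) (sym (*-assoc x _ _))

  ^ℚ-distribʳ-* : ∀ x y a → (x * y) ^ℚ a ≡ x ^ℚ a * y ^ℚ a
  ^ℚ-distribʳ-* x y zero    = refl
  ^ℚ-distribʳ-* x y (suc a) = trans (cong (x * y *_) (^ℚ-distribʳ-* x y a))
                                    (*-interchange x y (x ^ℚ a) (y ^ℚ a))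
    where
    open import Algebra.Bundles using (CommutativeMonoid)
    open import Algebra.Properties.CommutativeSemigroup (CommutativeMonoid.commutativeSemigroup *-1-commutativeMonoid)
      using () renaming (interchange to *-interchange)

  ^ℚ-*-assoc : ∀ x a b → (x ^ℚ a) ^ℚ b ≡ x ^ℚ (a ℕ.* b)
  ^ℚ-*-assoc x a zero    = cong (x ^ℚ_) (sym (ℕP.*-zeroʳ a))
  ^ℚ-*-assoc x a (suc b) = begin
    x ^ℚ a * (x ^ℚ a) ^ℚ b     ≡⟨ cong (x ^ℚ a *_) (^ℚ-*-assoc x a b) ⟩
    x ^ℚ a * x ^ℚ (a ℕ.* b)    ≡⟨ ^ℚ-distribˡ-+-* x a (a ℕ.* b) ⟨
    x ^ℚ (a ℕ.+ a ℕ.* b)       ≡⟨ cong (x ^ℚ_) (ℕP.*-suc a b) ⟨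
    x ^ℚ (a ℕ.* suc b)         ∎
    where open ≡-Reasoning

  ^ℚ-identityʳ : ∀ x → x ^ℚ 1 ≡ x
  ^ℚ-identityʳ = *-identityʳ

  ^ℚ-zeroˡ : ∀ a → 0ℚ ^ℚ suc a ≡ 0ℚ
  ^ℚ-zeroˡ a = *-zeroˡ (0ℚ ^ℚ a)

  ^ℚ-nonNeg : ∀ {x} a → 0ℚ ≤ x → 0ℚ ≤ x ^ℚ a
  ^ℚ-nonNeg zero    _   = ≤ᵇ⇒≤ _
  ^ℚ-nonNeg (suc a) 0≤x = *-nonNeg 0≤x (^ℚ-nonNeg a 0≤x)

  ^ℚ-pos : ∀ {x} a → 0ℚ < x → 0ℚ < x ^ℚ a
  ^ℚ-pos zero    _   = positive⁻¹ 1ℚ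
  ^ℚ-pos (suc a) 0<x = *-pos 0<x (^ℚ-pos a 0<x)

  ^ℚ-monoˡ-≤ : ∀ {x y} a → 0ℚ ≤ x → x ≤ y → x ^ℚ a ≤ y ^ℚ a
  ^ℚ-monoˡ-≤ zero    _   _   = ≤-refl
  ^ℚ-monoˡ-≤ (suc a) 0≤x x≤y = *-mono-≤-0≤ 0≤x (^ℚ-nonNeg a 0≤x) x≤y (^ℚ-monoˡ-≤ a 0≤x x≤y)

  ^ℚ-antiʳ-≤ : ∀ {x a b} → 0ℚ ≤ x → x ≤ 1ℚ → a ℕ.≤ b → x ^ℚ b ≤ x ^ℚ a
  ^ℚ-antiʳ-≤ {x} {zero} {zero}  _   _   _ = ≤-refl
  ^ℚ-antiʳ-≤ {x} {zero} {suc b} 0≤x x≤1 _ =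
    *-mono-≤-0≤ 0≤x (^ℚ-nonNeg b 0≤x) x≤1 (^ℚ-antiʳ-≤ {a = 0} {b} 0≤x x≤1 ℕ.z≤n)
  ^ℚ-antiʳ-≤ {x} {suc a} {suc b} 0≤x x≤1 (ℕ.s≤s a≤b) = *-monoˡ-≤-0≤ 0≤x (^ℚ-antiʳ-≤ 0≤x x≤1 a≤b)

  ^ℚ-≤-self : ∀ {x m} → 0ℚ ≤ x → x ≤ 1ℚ → 1 ℕ.≤ m → x ^ℚ m ≤ x
  ^ℚ-≤-self {x} 0≤x x≤1 1≤m = ≤-trans (^ℚ-antiʳ-≤ 0≤x x≤1 1≤m) (≤-reflexive (^ℚ-identityʳ x))

  tᵈ*xᵐ≤tᵐ⁺ᵈ+xᵐ⁺ᵈ : ∀ {t x} d m → 0ℚ ≤ t → 0ℚ ≤ x →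
    t ^ℚ d * x ^ℚ m ≤ t ^ℚ (m ℕ.+ d) + x ^ℚ (m ℕ.+ d)
  tᵈ*xᵐ≤tᵐ⁺ᵈ+xᵐ⁺ᵈ {t} {x} d m 0≤t 0≤x with ≤-total x t
  ... | inj₁ x≤t = begin
    t ^ℚ d * x ^ℚ m                      ≤⟨ *-monoˡ-≤-0≤ (^ℚ-nonNeg d 0≤t) (^ℚ-monoˡ-≤ m 0≤x x≤t) ⟩
    t ^ℚ d * t ^ℚ m                      ≡⟨ trans (*-comm (t ^ℚ d) _) (sym (^ℚ-distribˡ-+-* t m d)) ⟩
    t ^ℚ (m ℕ.+ d)                       ≤⟨ p≤p+q (^ℚ-nonNeg (m ℕ.+ d) 0≤x) ⟩
    t ^ℚ (m ℕ.+ d) + x ^ℚ (m ℕ.+ d)      ∎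
    where open ≤-Reasoning
  ... | inj₂ t≤x = begin
    t ^ℚ d * x ^ℚ m                      ≤⟨ *-monoʳ-≤-0≤ (^ℚ-nonNeg m 0≤x) (^ℚ-monoˡ-≤ d 0≤t t≤x) ⟩
    x ^ℚ d * x ^ℚ m                      ≡⟨ trans (*-comm (x ^ℚ d) _) (sym (^ℚ-distribˡ-+-* x m d)) ⟩
    x ^ℚ (m ℕ.+ d)                       ≤⟨ p≤q+p (^ℚ-nonNeg (m ℕ.+ d) 0≤t) ⟩
    t ^ℚ (m ℕ.+ d) + x ^ℚ (m ℕ.+ d)      ∎
    where open ≤-Reasoning

  ≤ᵇ≡false⇒> : ∀ {p q} → (p ≤ᵇ q) ≡ false → q < p
  ≤ᵇ≡false⇒> p≤ᵇq≡false = ≰⇒> (λ p≤q → subst T p≤ᵇq≡false (≤⇒≤ᵇ p≤q))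

  ≤⇒≤ᵇ≡true : ∀ {p q} → p ≤ q → (p ≤ᵇ q) ≡ true
  ≤⇒≤ᵇ≡true p≤q = Equivalence.to T-≡ (≤⇒≤ᵇ p≤q)

  p<q⇒0<q-p : ∀ {p q} → p < q → 0ℚ < q - p
  p<q⇒0<q-p {p} p<q = ≤-<-trans (≤-reflexive (sym (+-inverseʳ p))) (+-monoˡ-< (- p) p<q)

  large-complement : ∀ {z y X β} → z + y ≡ X → z < (1ℚ - β) * X → β * X ≤ y
  large-complement {z} {y} {X} {β} z+y≡X z<[1-β]X = begin
    β * X              ≡⟨ solve 3 (λ β X z → β :* X := β :* X :+ z :- z) refl β X z ⟩
    β * X + z - z      ≤⟨ +-monoˡ-≤ (- z) βX+z≤z+y ⟩
    z + y - z          ≡⟨ solve 2 (λ z y → z :+ y :- z := y) refl z y ⟩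
    y                  ∎
    where
    open ≤-Reasoning
    βX+z≤z+y : β * X + z ≤ z + y
    βX+z≤z+y = begin
      β * X + z                ≤⟨ +-monoʳ-≤ (β * X) (<⇒≤ z<[1-β]X) ⟩
      β * X + (1ℚ - β) * X     ≡⟨ solve 2 (λ β X → β :* X :+ (con 1ℚ :- β) :* X := X) refl β X ⟩
      X                        ≡⟨ z+y≡X ⟨
      z + y                    ∎

  cancel-bound : ∀ {w a g f δ Q} → 0ℚ < w → 0ℚ ≤ Q → g ≤ δ → f ≤ w * δ →
    w * a ≤ w * (g * Q) + f * Q → a ≤ (δ + δ) * Q
  cancel-bound {w} {a} {g} {f} {δ} {Q} 0<w 0≤Q g≤δ f≤wδ wa≤ = *-cancelˡ-≤-0< 0<w (begin
    w * a                          ≤⟨ wa≤ ⟩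
    w * (g * Q) + f * Q            ≤⟨ +-mono-≤ (*-monoˡ-≤-0≤ (<⇒≤ 0<w) (*-monoʳ-≤-0≤ 0≤Q g≤δ))
                                               (*-monoʳ-≤-0≤ 0≤Q f≤wδ) ⟩
    w * (δ * Q) + (w * δ) * Q      ≡⟨ solve 3 (λ w δ Q → w :* (δ :* Q) :+ (w :* δ) :* Q := w :* ((δ :+ δ) :* Q))
                                            refl w δ Q ⟩
    w * ((δ + δ) * Q)              ∎)
    where open ≤-Reasoning

module RationalSums where
  open import Data.Nat as ℕ using (ℕ)
  open import Data.Rational
  open import Data.Rational.Properties
  open import Data.List using (List; []; _∷_; length)
  open import Data.List.Membership.Propositional using (_∈_; find)
  open import Data.List.Relation.Unary.Any using (here; there; any?)
  open import Data.List.Relation.Unary.All using (All; _∷_)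
  import Data.List.Relation.Unary.All as All
  open import Data.List.Relation.Unary.All.Properties using (¬Any⇒All¬)
  open import Data.Product using (_×_; ∃)
  open import Data.Empty using (⊥-elim)
  open import Relation.Nullary using (yes; no)
  open import Relation.Binary.PropositionalEquality
  open import Algebra.Bundles using (CommutativeRing)
  open import Data.Bool using (Bool; true; false; _∧_; not)
  open import Defs using (ℕ→ℚ; allB)
  open Rationals
  open FiniteSum (CommutativeRing.commutativeSemiring +-*-commutativeRing) public

  private variable A : Set

  Σ-mono-≤ : ∀ {f g : A → ℚ} L → (∀ x → x ∈ L → f x ≤ g x) → Σ f L ≤ Σ g L
  Σ-mono-≤ []      f≤g = ≤-refl
  Σ-mono-≤ (x ∷ L) f≤g = +-mono-≤ (f≤g x (here refl)) (Σ-mono-≤ L (λ y y∈L → f≤g y (there y∈L)))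

  Σ-const : ∀ r (L : List A) → Σ (λ _ → r) L ≡ ℕ→ℚ (length L) * r
  Σ-const r []      = sym (*-zeroˡ r)
  Σ-const r (x ∷ L) = begin
    r + Σ (λ _ → r) L              ≡⟨ cong (r +_) (Σ-const r L) ⟩
    r + ℕ→ℚ (length L) * r         ≡⟨ cong (_+ ℕ→ℚ (length L) * r) (*-identityˡ r) ⟨
    1ℚ * r + ℕ→ℚ (length L) * r    ≡⟨ *-distribʳ-+ r 1ℚ (ℕ→ℚ (length L)) ⟨
    (1ℚ + ℕ→ℚ (length L)) * r      ≡⟨ cong (_* r) (ℕ→ℚ-homo-+ 1 (length L)) ⟨
    ℕ→ℚ (length (x ∷ L)) * r       ∎
    where open ≡-Reasoning

  ℕ→ℚ-homo-Σ : ∀ (f : A → ℕ) L → ℕ→ℚ (Counting.Σ f L) ≡ Σ (λ x → ℕ→ℚ (f x)) L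
  ℕ→ℚ-homo-Σ f []      = refl
  ℕ→ℚ-homo-Σ f (x ∷ L) = trans (ℕ→ℚ-homo-+ (f x) _) (cong (ℕ→ℚ (f x) +_) (ℕ→ℚ-homo-Σ f L))

  Σ-<-length-* : ∀ {f : A → ℚ} {c} y L → All (λ x → f x < c) (y ∷ L) →
    Σ f (y ∷ L) < ℕ→ℚ (length (y ∷ L)) * c
  Σ-<-length-* {f = f} {c} y L (fy<c ∷ fL<c) = begin-strict
    f y + Σ f L                   <⟨ +-mono-<-≤ fy<c (Σ-mono-≤ L (λ x x∈L → <⇒≤ (All.lookup fL<c x∈L))) ⟩
    c + Σ (λ _ → c) L             ≡⟨ Σ-const c (y ∷ L) ⟩
    ℕ→ℚ (length (y ∷ L)) * c      ∎
    where open ≤-Reasoning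

  pigeonhole : ∀ (f : A → ℚ) {c M} L → 0ℚ < c → 0ℚ < M → ℕ→ℚ (length L) ≤ M →
    M * c ≤ Σ f L → ∃ λ x → x ∈ L × c ≤ f x
  pigeonhole f {c} {M} L 0<c 0<M length≤M Mc≤Σ with any? (λ x → c ≤? f x) L
  ... | yes witness = find witness
  ... | no  none    = ⊥-elim (<-irrefl refl (<-≤-trans (Σ<Mc L length≤M (¬Any⇒All¬ L none)) Mc≤Σ))
    where
    Σ<Mc : ∀ L → ℕ→ℚ (length L) ≤ M → All (λ x → c ≰ f x) L → Σ f L < M * c
    Σ<Mc []      _        _   = *-pos 0<M 0<c
    Σ<Mc (y ∷ L) length≤M c≰f = <-≤-trans (Σ-<-length-* y L (All.map ≰⇒> c≰f))
                                          (*-monoʳ-≤-0≤ (<⇒≤ 0<c) length≤M)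

  keepIf-nonNeg : ∀ b {r} → 0ℚ ≤ r → 0ℚ ≤ keepIf b r
  keepIf-nonNeg true  0≤r = 0≤r
  keepIf-nonNeg false _   = ≤-refl

  keepIf-not-∧ : ∀ a b {r} → 0ℚ ≤ r → keepIf (not (a ∧ b)) r ≤ keepIf (not a) r + keepIf (not b) r
  keepIf-not-∧ true  b 0≤r = p≤q+p ≤-refl
  keepIf-not-∧ false b 0≤r = p≤p+q (keepIf-nonNeg (not b) 0≤r)

  keepIf-not-allB : ∀ (P : A → Bool) L {r} → 0ℚ ≤ r →
    keepIf (not (allB P L)) r ≤ Σ (λ x → keepIf (not (P x)) r) L
  keepIf-not-allB P []      0≤r = ≤-refl
  keepIf-not-allB P (x ∷ L) 0≤r =
    ≤-trans (keepIf-not-∧ (P x) (allB P L) 0≤r) (+-monoʳ-≤ (keepIf (not (P x)) _) (keepIf-not-allB P L 0≤r))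

  keepIf-not-true-∧ : ∀ {a} b r → a ≡ true → keepIf (not (a ∧ b)) r ≡ keepIf (not b) r
  keepIf-not-true-∧ b r refl = refl

module Graphs {n : Data.Nat.ℕ} (G : Defs.Graph n) where
  open import Data.Nat
  open import Data.Bool using (Bool; false; _∧_)
  open import Data.Fin using (Fin)
  open import Data.List using (List; _∷_; length; allFin)
  open import Data.List.Properties using (length-tabulate)
  open import Data.List.Membership.Propositional.Properties using (∈-allFin)
  open import Relation.Binary.PropositionalEquality
  open import Defs using (adj; seqsOf; allB; count; twoE; N; nb)
  import Defs
  open Counting

  V : List (Fin n)
  V = allFin n

  deg : Fin n → ℕ
  deg v = count (adj G v) V

  length-V : length V ≡ n
  length-V = length-tabulate (λ v → v)

  twoE≡Σ-deg : twoE G ≡ Σ deg V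
  twoE≡Σ-deg = sum-map deg V

  Σ-nb≡Σ-deg^ : ∀ j → Σ (nb G) (seqsOf j V) ≡ Σ (λ v → deg v ^ j) V
  Σ-nb≡Σ-deg^ j = begin
      Σ (nb G) (seqsOf j V)
    ≡⟨ Σ-cong (seqsOf j V) (λ S → count-≡-Σ (λ v → allB (adj G v) S) V) ⟩
      Σ (λ S → Σ (λ v → keepIf (allB (adj G v) S) 1) V) (seqsOf j V)
    ≡⟨ Σ-comm (λ S v → keepIf (allB (adj G v) S) 1) (seqsOf j V) V ⟩
      Σ (λ v → Σ (λ S → keepIf (allB (adj G v) S) 1) (seqsOf j V)) V
    ≡⟨ Σ-cong V (λ v → trans (sym (count-≡-Σ (allB (adj G v)) (seqsOf j V)))
                             (count-seqsOf-allB (adj G v) j V)) ⟩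
      Σ (λ v → deg v ^ j) V
    ∎
    where open ≡-Reasoning

  Σ-count-N≡Σ-nb^ : ∀ (Q : List (Fin n) → Bool) k k′ →
    Σ (λ T → count Q (seqsOf k′ (N G T))) (seqsOf k V) ≡ Σ (λ U → keepIf (Q U) (nb G U ^ k)) (seqsOf k′ V)
  Σ-count-N≡Σ-nb^ Q k k′ = begin
      Σ (λ T → count Q (seqsOf k′ (N G T))) (seqsOf k V)
    ≡⟨ Σ-cong (seqsOf k V) (λ T → trans (count-≡-Σ Q (seqsOf k′ (N G T))) (Σ-seqsOf-boolFilter _ (λ v → allB (adj G v) T) k′ V)) ⟩
      Σ (λ T → Σ (λ U → keepIf (U ⊆N T) (keepIf (Q U) 1)) (seqsOf k′ V)) (seqsOf k V)
    ≡⟨ Σ-comm _ (seqsOf k V) (seqsOf k′ V) ⟩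
      Σ (λ U → Σ (λ T → keepIf (U ⊆N T) (keepIf (Q U) 1)) (seqsOf k V)) (seqsOf k′ V)
    ≡⟨ Σ-cong (seqsOf k′ V) (λ U → trans (Σ-cong (seqsOf k V) (λ T → keepIf-comm (U ⊆N T) (Q U) 1))
                                         (sym (keepIf-Σ (Q U) _ (seqsOf k V)))) ⟩
      Σ (λ U → keepIf (Q U) (Σ (λ T → keepIf (U ⊆N T) 1) (seqsOf k V))) (seqsOf k′ V)
    ≡⟨ Σ-cong (seqsOf k′ V) (λ U → cong (keepIf (Q U)) (common-neighbours U)) ⟩
      Σ (λ U → keepIf (Q U) (nb G U ^ k)) (seqsOf k′ V)
    ∎
    where
    open ≡-Reasoning
    _⊆N_ : List (Fin n) → List (Fin n) → Bool
    U ⊆N T = allB (λ v → allB (adj G v) T) U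
    common-neighbours : ∀ U → Σ (λ T → keepIf (U ⊆N T) 1) (seqsOf k V) ≡ nb G U ^ k
    common-neighbours U = begin
        Σ (λ T → keepIf (U ⊆N T) 1) (seqsOf k V)
      ≡⟨ count-≡-Σ (λ T → U ⊆N T) (seqsOf k V) ⟨
        count (λ T → U ⊆N T) (seqsOf k V)
      ≡⟨ count-cong (seqsOf k V) (λ T → trans (allB-comm (adj G) T U)
                                  (allB-cong T (λ t → allB-cong U (λ u → Defs.sym G u t)))) ⟩
        count (allB (λ t → allB (adj G t) U)) (seqsOf k V)
      ≡⟨ count-seqsOf-allB (λ t → allB (adj G t) U) k V ⟩
        nb G U ^ k
      ∎

  twoE≡0⇒nb∷≡0 : twoE G ≡ 0 → ∀ v S → nb G (v ∷ S) ≡ 0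
  twoE≡0⇒nb∷≡0 twoE≡0 v S =
    false⇒count≡0 (λ w → allB (adj G w) (v ∷ S)) V (λ w → cong (_∧ allB (adj G w) S) (no-edges w v))
    where
    no-edges : ∀ w v → adj G w v ≡ false
    no-edges w v = count≡0⇒false (adj G w) (Σ≡0⇒≡0 deg (trans (sym twoE≡Σ-deg) twoE≡0) (∈-allFin w)) (∈-allFin v)

module StarCount {n : Data.Nat.ℕ} (G : Defs.Graph n) where
  open import Data.Nat as ℕ using (ℕ; suc)
  open import Data.Rational
  open import Data.Rational.Properties
  open import Relation.Binary.PropositionalEquality
  open import Data.Rational.Solver using (module +-*-Solver)
  open +-*-Solver using (solve; _:=_; _:*_)
  open import Data.List using (length)
  open import Defs using (ℕ→ℚ; _^ℚ_; density; twoE; nb; seqsOf)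
  open Rationals
  open Graphs G
  open PowerMean using (power-mean)

  -- Σ_T |N(T)| counts the homomorphic copies of the star K_{1,j+1}.
  Σ-nb-lower-bound : 1 ℕ.≤ n → ∀ j →
    ℕ→ℚ n ^ℚ suc (suc j) * density G ^ℚ suc j ≤ ℕ→ℚ (Counting.Σ (nb G) (seqsOf (suc j) V))
  Σ-nb-lower-bound 1≤n j = *-cancelˡ-≤-0< (^ℚ-pos j (ℕ→ℚ-pos 1≤n)) (begin
      nʲ * (ℕ→ℚ n ^ℚ suc (suc j) * p ^ℚ suc j)
    ≡⟨ solve 3 (λ P N Nʲ → Nʲ :* ((N :* (N :* Nʲ)) :* P) := P :* ((N :* Nʲ) :* (N :* Nʲ))) refl (p ^ℚ suc j) (ℕ→ℚ n) nʲ ⟩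
      p ^ℚ suc j * (ℕ→ℚ n ^ℚ suc j * ℕ→ℚ n ^ℚ suc j)
    ≡⟨ cong (p ^ℚ suc j *_) (^ℚ-distribʳ-* (ℕ→ℚ n) (ℕ→ℚ n) (suc j)) ⟨
      p ^ℚ suc j * (ℕ→ℚ n * ℕ→ℚ n) ^ℚ suc j
    ≡⟨ ^ℚ-distribʳ-* p (ℕ→ℚ n * ℕ→ℚ n) (suc j) ⟨
      (p * (ℕ→ℚ n * ℕ→ℚ n)) ^ℚ suc j
    ≡⟨ cong (_^ℚ suc j) (ratioSq-*-sq (twoE G) 1≤n) ⟩
      ℕ→ℚ (twoE G) ^ℚ suc j
    ≡⟨ ℕ→ℚ-homo-^ (twoE G) (suc j) ⟨
      ℕ→ℚ (twoE G ℕ.^ suc j)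
    ≤⟨ ℕ→ℚ-mono-≤ (subst (λ e → e ℕ.^ suc j ℕ.≤ length V ℕ.^ j ℕ.* Counting.Σ (λ v → deg v ℕ.^ suc j) V)
                         (sym twoE≡Σ-deg) (power-mean deg V j)) ⟩
      ℕ→ℚ (length V ℕ.^ j ℕ.* Counting.Σ (λ v → deg v ℕ.^ suc j) V)
    ≡⟨ ℕ→ℚ-homo-* (length V ℕ.^ j) _ ⟩
      ℕ→ℚ (length V ℕ.^ j) * ℕ→ℚ (Counting.Σ (λ v → deg v ℕ.^ suc j) V)
    ≡⟨ cong₂ _*_ (trans (cong (λ l → ℕ→ℚ (l ℕ.^ j)) length-V) (ℕ→ℚ-homo-^ n j))
                 (cong ℕ→ℚ (sym (Σ-nb≡Σ-deg^ (suc j)))) ⟩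
      nʲ * ℕ→ℚ (Counting.Σ (nb G) (seqsOf (suc j) V))
    ∎)
    where
    open ≤-Reasoning
    p nʲ : ℚ
    p = density G
    nʲ = ℕ→ℚ n ^ℚ j

module BadMoments {n : Data.Nat.ℕ} (G : Defs.Graph n) (α β : Data.Rational.ℚ) (h : Data.Nat.ℕ) where
  open import Data.Nat as ℕ using (ℕ; suc; s≤s)
  import Data.Nat.Properties as ℕP
  open import Data.Bool using (Bool; true; false; _∧_; _∨_; not)
  open import Data.Fin using (Fin)
  open import Data.List using (List; length; upTo)
  open import Data.List.Properties using (length-upTo)
  open import Data.List.Membership.Propositional using (_∈_)
  open import Data.List.Membership.Propositional.Properties using (∈-upTo⁻)
  open import Data.Product using (proj₁; proj₂)
  open import Data.Rational
  open import Data.Rational.Properties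
  open import Relation.Binary.PropositionalEquality
  open import Relation.Nullary using (Dec; yes; no)
  open import Data.Rational.Solver using (module +-*-Solver)
  open +-*-Solver using (solve; _:=_; _:+_; _:*_)
  open import Defs using (ℕ→ℚ; _^ℚ_; density; nb; N; seqsOf; count; allB)
  open Defs.Goodness G α β h
  open Rationals
  open RationalSums
  open Graphs G using (V; length-V; Σ-count-N≡Σ-nb^)
  open Counting using (length-seqsOf; ∈-seqsOf⇒length; count-+-count-not; >⇒≤ᵇ≡false; ∨≡false⇒≡false)

  p nℚ : ℚ
  p  = density G
  nℚ = ℕ→ℚ n

  x : List (Fin n) → ℚ
  x T = ℕ→ℚ (nb G T)

  s : ℕ → ℚ
  s k = p ^ℚ k * nℚ

  Bad : ℕ → ℕ → ℕ → ℚ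
  Bad i k m = Σ (λ T → keepIf (not (good i T)) (x T ^ℚ m)) (seqsOf k V)

  BadBound : ℕ → ℚ → Set
  BadBound i e = ∀ k m → 1 ℕ.≤ m → m ℕ.≤ k → k ℕ.≤ h → Bad i k m ≤ e * (nℚ ^ℚ k * s k ^ℚ m)

  p-nonNeg : 0ℚ ≤ p
  p-nonNeg = ratioSq-nonNeg _ n

  x-nonNeg : ∀ T → 0ℚ ≤ x T
  x-nonNeg T = ℕ→ℚ-nonNeg (nb G T)

  s-nonNeg : ∀ k → 0ℚ ≤ s k
  s-nonNeg k = *-nonNeg (^ℚ-nonNeg k p-nonNeg) (ℕ→ℚ-nonNeg n)

  scale-nonNeg : ∀ k m → 0ℚ ≤ nℚ ^ℚ k * s k ^ℚ m
  scale-nonNeg k m = *-nonNeg (^ℚ-nonNeg k (ℕ→ℚ-nonNeg n)) (^ℚ-nonNeg m (s-nonNeg k))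

  length-seqsOf-V : ∀ k → ℕ→ℚ (length (seqsOf k V)) ≡ nℚ ^ℚ k
  length-seqsOf-V k = trans (cong ℕ→ℚ (trans (length-seqsOf k V) (cong (ℕ._^ k) length-V))) (ℕ→ℚ-homo-^ n k)

  Σ-const-seqsOf-V : ∀ k r → Σ (λ _ → r) (seqsOf k V) ≡ nℚ ^ℚ k * r
  Σ-const-seqsOf-V k r = trans (Σ-const r (seqsOf k V)) (cong (_* r) (length-seqsOf-V k))

  nℚ^-*-s^-comm : ∀ k k′ → nℚ ^ℚ k′ * s k′ ^ℚ k ≡ nℚ ^ℚ k * s k ^ℚ k′
  nℚ^-*-s^-comm k k′ = begin
      nℚ ^ℚ k′ * (p ^ℚ k′ * nℚ) ^ℚ k
    ≡⟨ cong (nℚ ^ℚ k′ *_) (trans (^ℚ-distribʳ-* (p ^ℚ k′) nℚ k) (cong (_* nℚ ^ℚ k) (^ℚ-*-assoc p k′ k))) ⟩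
      nℚ ^ℚ k′ * (p ^ℚ (k′ ℕ.* k) * nℚ ^ℚ k)
    ≡⟨ cong (λ e → nℚ ^ℚ k′ * (p ^ℚ e * nℚ ^ℚ k)) (ℕP.*-comm k′ k) ⟩
      nℚ ^ℚ k′ * (p ^ℚ (k ℕ.* k′) * nℚ ^ℚ k)
    ≡⟨ solve 3 (λ a b c → a :* (b :* c) := c :* (b :* a)) refl (nℚ ^ℚ k′) (p ^ℚ (k ℕ.* k′)) (nℚ ^ℚ k) ⟩
      nℚ ^ℚ k * (p ^ℚ (k ℕ.* k′) * nℚ ^ℚ k′)
    ≡⟨ cong (nℚ ^ℚ k *_) (trans (^ℚ-distribʳ-* (p ^ℚ k) nℚ k′) (cong (_* nℚ ^ℚ k′) (^ℚ-*-assoc p k k′))) ⟨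
      nℚ ^ℚ k * (p ^ℚ k * nℚ) ^ℚ k′
    ∎
    where open ≡-Reasoning

  BadBound-mono : ∀ {i e e′} → e ≤ e′ → BadBound i e → BadBound i e′
  BadBound-mono e≤e′ bound k m 1≤m m≤k k≤h = ≤-trans (bound k m 1≤m m≤k k≤h) (*-monoʳ-≤-0≤ (scale-nonNeg k m) e≤e′)

  module _ (0≤α : 0ℚ ≤ α) (α≤1 : α ≤ 1ℚ) where

    zeroGood-failure : ∀ k m → 1 ℕ.≤ m → ∀ {T} → T ∈ seqsOf k V →
      keepIf (not (zeroGood T)) (x T ^ℚ m) ≤ α * s k ^ℚ m
    zeroGood-failure k m 1≤m {T} T∈ = by-cases (zeroGood T) refl
      where
      open ≤-Reasoning
      by-cases : ∀ b → zeroGood T ≡ b → keepIf (not b) (x T ^ℚ m) ≤ α * s k ^ℚ m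
      by-cases true  _          = *-nonNeg 0≤α (^ℚ-nonNeg m (s-nonNeg k))
      by-cases false not-good = begin
          x T ^ℚ m            ≤⟨ ^ℚ-monoˡ-≤ m (x-nonNeg T) (<⇒≤ x<αs) ⟩
          (α * s k) ^ℚ m      ≡⟨ ^ℚ-distribʳ-* α (s k) m ⟩
          α ^ℚ m * s k ^ℚ m   ≤⟨ *-monoʳ-≤-0≤ (^ℚ-nonNeg m (s-nonNeg k)) (^ℚ-≤-self 0≤α α≤1 1≤m) ⟩
          α * s k ^ℚ m        ∎
        where
        x<αs : x T < α * s k
        x<αs = subst (x T <_) (trans (cong (λ l → α * p ^ℚ l * nℚ) (∈-seqsOf⇒length k V T∈)) (*-assoc α _ nℚ))
                     (≤ᵇ≡false⇒> {α * p ^ℚ length T * nℚ} {x T} not-good)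

    Σ-zeroGood-failure : ∀ k m → 1 ℕ.≤ m →
      Σ (λ T → keepIf (not (zeroGood T)) (x T ^ℚ m)) (seqsOf k V) ≤ α * (nℚ ^ℚ k * s k ^ℚ m)
    Σ-zeroGood-failure k m 1≤m = begin
        Σ (λ T → keepIf (not (zeroGood T)) (x T ^ℚ m)) (seqsOf k V)
      ≤⟨ Σ-mono-≤ (seqsOf k V) (λ T → zeroGood-failure k m 1≤m) ⟩
        Σ (λ _ → α * s k ^ℚ m) (seqsOf k V)
      ≡⟨ Σ-const-seqsOf-V k _ ⟩
        nℚ ^ℚ k * (α * s k ^ℚ m)
      ≡⟨ solve 3 (λ a b c → a :* (b :* c) := b :* (a :* c)) refl (nℚ ^ℚ k) α (s k ^ℚ m) ⟩
        α * (nℚ ^ℚ k * s k ^ℚ m)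
      ∎
      where open ≤-Reasoning

    BadBound-zero : BadBound 0 α
    BadBound-zero k m 1≤m _ _ = Σ-zeroGood-failure k m 1≤m

    module Step (0<β : 0ℚ < β) (0<p : 0ℚ < p) (0<n : 0ℚ < nℚ) (i : ℕ) {δ e : ℚ}
                (0<δ : 0ℚ < δ) (δ≤1 : δ ≤ 1ℚ) (e≤βδʰ⁺¹ : e ≤ β * δ ^ℚ suc h) (IH : BadBound i e) where

      dense : ℕ → List (Fin n) → Bool
      dense k′ T = (1ℚ - β) * (x T ^ℚ k′) ≤ᵇ ℕ→ℚ (count (good i) (seqsOf k′ (N G T)))

      requirement : ℕ → List (Fin n) → Bool
      requirement k′ T = not (length T ℕ.≤ᵇ k′) ∨ dense k′ T

      failures : ℕ → ℕ → List (Fin n) → ℚ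
      failures k′ m T = keepIf (not (requirement k′ T)) (x T ^ℚ m)

      not-good : ℕ → List (Fin n) → ℚ
      not-good k′ T = ℕ→ℚ (count (λ W → not (good i W)) (seqsOf k′ (N G T)))

      not-good-suc≤ : ∀ k m → k ℕ.≤ h → ∀ {T} → T ∈ seqsOf k V →
        keepIf (not (good (suc i) T)) (x T ^ℚ m) ≤
          keepIf (not (zeroGood T)) (x T ^ℚ m) + Σ (λ k′ → failures k′ m T) (upTo (suc h))
      not-good-suc≤ k m k≤h {T} T∈ = begin
          keepIf (not (good (suc i) T)) (x T ^ℚ m)
        ≡⟨ keepIf-not-true-∧ _ (x T ^ℚ m) (Counting.≤⇒≤ᵇ≡true (subst (ℕ._≤ h) (sym (∈-seqsOf⇒length k V T∈)) k≤h)) ⟩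
          keepIf (not (zeroGood T ∧ allB (λ k′ → requirement k′ T) (upTo (suc h)))) (x T ^ℚ m)
        ≤⟨ keepIf-not-∧ (zeroGood T) _ 0≤x^m ⟩
          keepIf (not (zeroGood T)) (x T ^ℚ m) + keepIf (not (allB (λ k′ → requirement k′ T) (upTo (suc h)))) (x T ^ℚ m)
        ≤⟨ +-monoʳ-≤ (keepIf (not (zeroGood T)) (x T ^ℚ m)) (keepIf-not-allB (λ k′ → requirement k′ T) (upTo (suc h)) 0≤x^m) ⟩
          keepIf (not (zeroGood T)) (x T ^ℚ m) + Σ (λ k′ → failures k′ m T) (upTo (suc h))
        ∎
        where
        open ≤-Reasoning
        0≤x^m : 0ℚ ≤ x T ^ℚ m
        0≤x^m = ^ℚ-nonNeg m (x-nonNeg T)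

      failures-below : ∀ {k′} k m → k′ ℕ.< k → ∀ {T} → T ∈ seqsOf k V → failures k′ m T ≡ 0ℚ
      failures-below {k′} k m k′<k {T} T∈ =
        cong (λ b → keepIf (not (not b ∨ dense k′ T)) (x T ^ℚ m))
             (>⇒≤ᵇ≡false (subst (k′ ℕ.<_) (sym (∈-seqsOf⇒length k V T∈)) k′<k))

      -- When the requirement fails, not-good is at least a β-fraction of x^(m+d), and
      -- t^d x^m ≤ t^(m+d) + x^(m+d) trades the weight x^m for that count.
      failure-bound : ∀ {t} d m → 0ℚ ≤ t → ∀ T →
        β * t ^ℚ d * failures (m ℕ.+ d) m T ≤ β * t ^ℚ (m ℕ.+ d) + not-good (m ℕ.+ d) T
      failure-bound {t} d m 0≤t T = by-cases (requirement (m ℕ.+ d) T) refl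
        where
        k′ : ℕ
        k′ = m ℕ.+ d
        mostly-not-good : dense k′ T ≡ false → β * x T ^ℚ k′ ≤ not-good k′ T
        mostly-not-good sparse =
          large-complement {β = β} good+not-good≡x^k′ (≤ᵇ≡false⇒> {(1ℚ - β) * (x T ^ℚ k′)} {ℕ→ℚ #good} sparse)
          where
          #good #not-good : ℕ
          #good     = count (good i) (seqsOf k′ (N G T))
          #not-good = count (λ W → not (good i W)) (seqsOf k′ (N G T))
          good+not-good≡x^k′ : ℕ→ℚ #good + not-good k′ T ≡ x T ^ℚ k′
          good+not-good≡x^k′ = begin
              ℕ→ℚ #good + ℕ→ℚ #not-good
            ≡⟨ ℕ→ℚ-homo-+ #good #not-good ⟨
              ℕ→ℚ (#good ℕ.+ #not-good)
            ≡⟨ cong ℕ→ℚ (trans (count-+-count-not (good i) (seqsOf k′ (N G T))) (length-seqsOf k′ (N G T))) ⟩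
              ℕ→ℚ (nb G T ℕ.^ k′)
            ≡⟨ ℕ→ℚ-homo-^ (nb G T) k′ ⟩
              x T ^ℚ k′
            ∎
            where open ≡-Reasoning
        by-cases : ∀ b → requirement k′ T ≡ b →
          β * t ^ℚ d * keepIf (not b) (x T ^ℚ m) ≤ β * t ^ℚ k′ + not-good k′ T
        by-cases true  _ = begin
          β * t ^ℚ d * 0ℚ                  ≡⟨ *-zeroʳ (β * t ^ℚ d) ⟩
          0ℚ                               ≤⟨ *-nonNeg (<⇒≤ 0<β) (^ℚ-nonNeg k′ 0≤t) ⟩
          β * t ^ℚ k′                      ≤⟨ p≤p+q (ℕ→ℚ-nonNeg (count (λ W → not (good i W)) (seqsOf k′ (N G T)))) ⟩
          β * t ^ℚ k′ + not-good k′ T      ∎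
          where open ≤-Reasoning
        by-cases false req = begin
          β * t ^ℚ d * x T ^ℚ m                 ≡⟨ *-assoc β _ _ ⟩
          β * (t ^ℚ d * x T ^ℚ m)               ≤⟨ *-monoˡ-≤-0≤ (<⇒≤ 0<β) (tᵈ*xᵐ≤tᵐ⁺ᵈ+xᵐ⁺ᵈ d m 0≤t (x-nonNeg T)) ⟩
          β * (t ^ℚ k′ + x T ^ℚ k′)             ≡⟨ *-distribˡ-+ β _ _ ⟩
          β * t ^ℚ k′ + β * x T ^ℚ k′           ≤⟨ +-monoʳ-≤ (β * t ^ℚ k′) (mostly-not-good (∨≡false⇒≡false (not (length T ℕ.≤ᵇ k′)) req)) ⟩
          β * t ^ℚ k′ + not-good k′ T           ∎
          where open ≤-Reasoning

      Σ-not-good≡Bad : ∀ k k′ → Σ (not-good k′) (seqsOf k V) ≡ Bad i k′ k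
      Σ-not-good≡Bad k k′ = begin
          Σ (not-good k′) (seqsOf k V)
        ≡⟨ ℕ→ℚ-homo-Σ (λ T → count (λ W → not (good i W)) (seqsOf k′ (N G T))) (seqsOf k V) ⟨
          ℕ→ℚ (Counting.Σ (λ T → count (λ W → not (good i W)) (seqsOf k′ (N G T))) (seqsOf k V))
        ≡⟨ cong ℕ→ℚ (Σ-count-N≡Σ-nb^ (λ W → not (good i W)) k k′) ⟩
          ℕ→ℚ (Counting.Σ (λ U → Counting.keepIf (not (good i U)) (nb G U ℕ.^ k)) (seqsOf k′ V))
        ≡⟨ ℕ→ℚ-homo-Σ (λ U → Counting.keepIf (not (good i U)) (nb G U ℕ.^ k)) (seqsOf k′ V) ⟩
          Σ (λ U → ℕ→ℚ (Counting.keepIf (not (good i U)) (nb G U ℕ.^ k))) (seqsOf k′ V)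
        ≡⟨ Σ-cong (seqsOf k′ V) (λ U → ℕ→ℚ-keepIf-^ (not (good i U)) (nb G U)) ⟩
          Bad i k′ k
        ∎
        where
        open ≡-Reasoning
        ℕ→ℚ-keepIf-^ : ∀ b a → ℕ→ℚ (Counting.keepIf b (a ℕ.^ k)) ≡ keepIf b (ℕ→ℚ a ^ℚ k)
        ℕ→ℚ-keepIf-^ true  a = ℕ→ℚ-homo-^ a k
        ℕ→ℚ-keepIf-^ false a = refl

      weighted-failures-bound : ∀ k m d → 1 ℕ.≤ m → m ℕ.≤ k → k ℕ.≤ m ℕ.+ d → m ℕ.+ d ℕ.≤ h →
        β * (δ * s k) ^ℚ d * Σ (failures (m ℕ.+ d) m) (seqsOf k V)
          ≤ nℚ ^ℚ k * (β * (δ * s k) ^ℚ (m ℕ.+ d)) + e * (nℚ ^ℚ k * s k ^ℚ (m ℕ.+ d))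
      weighted-failures-bound k m d 1≤m m≤k k≤k′ k′≤h = begin
          w * Σ (failures k′ m) (seqsOf k V)
        ≡⟨ Σ-*ˡ w (failures k′ m) (seqsOf k V) ⟨
          Σ (λ T → w * failures k′ m T) (seqsOf k V)
        ≤⟨ Σ-mono-≤ (seqsOf k V) (λ T _ → failure-bound d m (*-nonNeg (<⇒≤ 0<δ) (s-nonNeg k)) T) ⟩
          Σ (λ T → β * t ^ℚ k′ + not-good k′ T) (seqsOf k V)
        ≡⟨ Σ-+ (λ _ → β * t ^ℚ k′) (not-good k′) (seqsOf k V) ⟩
          Σ (λ _ → β * t ^ℚ k′) (seqsOf k V) + Σ (not-good k′) (seqsOf k V)
        ≡⟨ cong₂ _+_ (Σ-const-seqsOf-V k (β * t ^ℚ k′)) (Σ-not-good≡Bad k k′) ⟩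
          nℚ ^ℚ k * (β * t ^ℚ k′) + Bad i k′ k
        ≤⟨ +-monoʳ-≤ (nℚ ^ℚ k * (β * t ^ℚ k′)) (IH k′ k (ℕP.≤-trans 1≤m m≤k) k≤k′ k′≤h) ⟩
          nℚ ^ℚ k * (β * t ^ℚ k′) + e * (nℚ ^ℚ k′ * s k′ ^ℚ k)
        ≡⟨ cong (λ v → nℚ ^ℚ k * (β * t ^ℚ k′) + e * v) (nℚ^-*-s^-comm k k′) ⟩
          nℚ ^ℚ k * (β * t ^ℚ k′) + e * (nℚ ^ℚ k * s k ^ℚ k′)
        ∎
        where
        open ≤-Reasoning
        k′ : ℕ
        k′ = m ℕ.+ d
        t w : ℚ
        t = δ * s k
        w = β * t ^ℚ d

      failures-bound : ∀ k m d → 1 ℕ.≤ m → m ℕ.≤ k → k ℕ.≤ m ℕ.+ d → m ℕ.+ d ℕ.≤ h →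
        Σ (failures (m ℕ.+ d) m) (seqsOf k V) ≤ (δ + δ) * (nℚ ^ℚ k * s k ^ℚ m)
      failures-bound k m d 1≤m m≤k k≤k′ k′≤h =
        cancel-bound 0<w (scale-nonNeg k m) (^ℚ-≤-self 0≤δ δ≤1 1≤m) e*Sᵈ≤w*δ
          (≤-trans (weighted-failures-bound k m d 1≤m m≤k k≤k′ k′≤h) (≤-reflexive regroup))
        where
        open ≤-Reasoning
        S t w : ℚ
        S = s k
        t = δ * S
        w = β * t ^ℚ d
        0≤δ : 0ℚ ≤ δ
        0≤δ = <⇒≤ 0<δ
        0<w : 0ℚ < w
        0<w = *-pos 0<β (^ℚ-pos d (*-pos 0<δ (*-pos (^ℚ-pos k 0<p) 0<n)))
        e*Sᵈ≤w*δ : e * S ^ℚ d ≤ w * δ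
        e*Sᵈ≤w*δ = begin
          e * S ^ℚ d                         ≤⟨ *-monoʳ-≤-0≤ (^ℚ-nonNeg d (s-nonNeg k)) e≤βδᵈ⁺¹ ⟩
          β * (δ * δ ^ℚ d) * S ^ℚ d          ≡⟨ solve 4 (λ β δ δᵈ Sᵈ → β :* (δ :* δᵈ) :* Sᵈ := β :* (δᵈ :* Sᵈ) :* δ)
                                                      refl β δ (δ ^ℚ d) (S ^ℚ d) ⟩
          β * (δ ^ℚ d * S ^ℚ d) * δ          ≡⟨ cong (λ u → β * u * δ) (^ℚ-distribʳ-* δ S d) ⟨
          w * δ                              ∎
          where
          e≤βδᵈ⁺¹ : e ≤ β * (δ * δ ^ℚ d)
          e≤βδᵈ⁺¹ = ≤-trans e≤βδʰ⁺¹ (*-monoˡ-≤-0≤ (<⇒≤ 0<β)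
                      (^ℚ-antiʳ-≤ 0≤δ δ≤1 (s≤s (ℕP.≤-trans (ℕP.m≤n+m d m) k′≤h))))
        regroup : nℚ ^ℚ k * (β * t ^ℚ (m ℕ.+ d)) + e * (nℚ ^ℚ k * S ^ℚ (m ℕ.+ d))
                    ≡ w * (δ ^ℚ m * (nℚ ^ℚ k * S ^ℚ m)) + e * S ^ℚ d * (nℚ ^ℚ k * S ^ℚ m)
        regroup = begin-equality
            nℚ ^ℚ k * (β * t ^ℚ (m ℕ.+ d)) + e * (nℚ ^ℚ k * S ^ℚ (m ℕ.+ d))
          ≡⟨ cong₂ (λ u v → nℚ ^ℚ k * (β * u) + e * (nℚ ^ℚ k * v))
                   (trans (^ℚ-distribʳ-* δ S (m ℕ.+ d)) (cong₂ _*_ (^ℚ-distribˡ-+-* δ m d) (^ℚ-distribˡ-+-* S m d)))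
                   (^ℚ-distribˡ-+-* S m d) ⟩
            nℚ ^ℚ k * (β * ((δ ^ℚ m * δ ^ℚ d) * (S ^ℚ m * S ^ℚ d))) + e * (nℚ ^ℚ k * (S ^ℚ m * S ^ℚ d))
          ≡⟨ solve 7 (λ N β δᵐ δᵈ Sᵐ Sᵈ e →
                 N :* (β :* ((δᵐ :* δᵈ) :* (Sᵐ :* Sᵈ))) :+ e :* (N :* (Sᵐ :* Sᵈ))
                   := β :* (δᵈ :* Sᵈ) :* (δᵐ :* (N :* Sᵐ)) :+ e :* Sᵈ :* (N :* Sᵐ))
                 refl (nℚ ^ℚ k) β (δ ^ℚ m) (δ ^ℚ d) (S ^ℚ m) (S ^ℚ d) e ⟩
            β * (δ ^ℚ d * S ^ℚ d) * (δ ^ℚ m * (nℚ ^ℚ k * S ^ℚ m)) + e * S ^ℚ d * (nℚ ^ℚ k * S ^ℚ m)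
          ≡⟨ cong (λ u → β * u * (δ ^ℚ m * (nℚ ^ℚ k * S ^ℚ m)) + e * S ^ℚ d * (nℚ ^ℚ k * S ^ℚ m))
                  (^ℚ-distribʳ-* δ S d) ⟨
            w * (δ ^ℚ m * (nℚ ^ℚ k * S ^ℚ m)) + e * S ^ℚ d * (nℚ ^ℚ k * S ^ℚ m)
          ∎

      failures-bound-≤h : ∀ k m → 1 ℕ.≤ m → m ℕ.≤ k → ∀ k′ → k′ ∈ upTo (suc h) →
        Σ (failures k′ m) (seqsOf k V) ≤ (δ + δ) * (nℚ ^ℚ k * s k ^ℚ m)
      failures-bound-≤h k m 1≤m m≤k k′ k′∈ = by-cases (k′ ℕ.<? k)
        where
        open ≤-Reasoning
        by-cases : Dec (k′ ℕ.< k) → Σ (failures k′ m) (seqsOf k V) ≤ (δ + δ) * (nℚ ^ℚ k * s k ^ℚ m)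
        by-cases (yes k′<k) = begin
          Σ (failures k′ m) (seqsOf k V)      ≤⟨ Σ-mono-≤ (seqsOf k V) (λ T T∈ → ≤-reflexive (failures-below k m k′<k T∈)) ⟩
          Σ (λ _ → 0ℚ) (seqsOf k V)           ≡⟨ Σ-zero (seqsOf k V) ⟩
          0ℚ                                  ≤⟨ *-nonNeg (≤-trans (<⇒≤ 0<δ) (p≤p+q (<⇒≤ 0<δ))) (scale-nonNeg k m) ⟩
          (δ + δ) * (nℚ ^ℚ k * s k ^ℚ m)      ∎
        by-cases (no k′≮k) = subst (λ l → Σ (failures l m) (seqsOf k V) ≤ (δ + δ) * (nℚ ^ℚ k * s k ^ℚ m)) m+d≡k′
                                (failures-bound k m d 1≤m m≤k (subst (k ℕ.≤_) (sym m+d≡k′) k≤k′)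
                                                            (subst (ℕ._≤ h) (sym m+d≡k′) (ℕP.≤-pred (∈-upTo⁻ k′∈))))
          where
          k≤k′ : k ℕ.≤ k′
          k≤k′ = ℕP.≮⇒≥ k′≮k
          d : ℕ
          d = proj₁ (ℕP.m≤n⇒∃[o]m+o≡n (ℕP.≤-trans m≤k k≤k′))
          m+d≡k′ : m ℕ.+ d ≡ k′
          m+d≡k′ = proj₂ (ℕP.m≤n⇒∃[o]m+o≡n (ℕP.≤-trans m≤k k≤k′))

      BadBound-suc : BadBound (suc i) (α + ℕ→ℚ (suc h) * (δ + δ))
      BadBound-suc k m 1≤m m≤k k≤h = begin
          Bad (suc i) k m
        ≤⟨ Σ-mono-≤ (seqsOf k V) (λ T → not-good-suc≤ k m k≤h) ⟩
          Σ (λ T → zeroGood-fail T + Σ (λ k′ → failures k′ m T) (upTo (suc h))) (seqsOf k V)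
        ≡⟨ Σ-+ zeroGood-fail _ (seqsOf k V) ⟩
          Σ zeroGood-fail (seqsOf k V) + Σ (λ T → Σ (λ k′ → failures k′ m T) (upTo (suc h))) (seqsOf k V)
        ≡⟨ cong (Σ zeroGood-fail (seqsOf k V) +_) (Σ-comm (λ T k′ → failures k′ m T) (seqsOf k V) (upTo (suc h))) ⟩
          Σ zeroGood-fail (seqsOf k V) + Σ (λ k′ → Σ (failures k′ m) (seqsOf k V)) (upTo (suc h))
        ≤⟨ +-mono-≤ (Σ-zeroGood-failure k m 1≤m) (Σ-mono-≤ (upTo (suc h)) (failures-bound-≤h k m 1≤m m≤k)) ⟩
          α * Q + Σ (λ _ → (δ + δ) * Q) (upTo (suc h))
        ≡⟨ cong (α * Q +_) (trans (Σ-const _ (upTo (suc h))) (cong (λ l → ℕ→ℚ l * ((δ + δ) * Q)) (length-upTo (suc h)))) ⟩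
          α * Q + ℕ→ℚ (suc h) * ((δ + δ) * Q)
        ≡⟨ solve 4 (λ a c d q → a :* q :+ c :* (d :* q) := (a :+ c :* d) :* q) refl α (ℕ→ℚ (suc h)) (δ + δ) Q ⟩
          (α + ℕ→ℚ (suc h) * (δ + δ)) * Q
        ∎
        where
        open ≤-Reasoning
        Q : ℚ
        Q = nℚ ^ℚ k * s k ^ℚ m
        zeroGood-fail : List (Fin n) → ℚ
        zeroGood-fail T = keepIf (not (zeroGood T)) (x T ^ℚ m)

module Constants (β : Data.Rational.ℚ) (h : Data.Nat.ℕ) (0<β : β Data.Rational.> Data.Rational.0ℚ)
                 (β≤1 : β Data.Rational.≤ Data.Rational.1ℚ) where
  open import Data.Nat as ℕ using (ℕ; zero; suc; z≤n; s≤s)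
  import Data.Nat.Properties as ℕP
  open import Data.Rational
  open import Data.Rational.Properties
  open import Data.Product using (_,_)
  open import Relation.Binary.PropositionalEquality
  open import Data.Rational.Solver using (module +-*-Solver)
  open +-*-Solver using (solve; _:=_; _:+_; _:*_; con)
  open import Defs using (ℕ→ℚ; _^ℚ_)
  open Rationals

  private
    c : ℚ
    c = ℕ→ℚ (suc h)

    0<c : 0ℚ < c
    0<c = ℕ→ℚ-pos {suc h} (s≤s z≤n)

    instance
      c-nonZero : NonZero c
      c-nonZero = pos⇒nonZero c {{positive 0<c}}

    q : ℚ
    q = ½ * ½ * 1/ c

    c*q≡¼ : c * q ≡ ½ * ½
    c*q≡¼ = trans (solve 3 (λ c a i → c :* (a :* i) := a :* (c :* i)) refl c (½ * ½) (1/ c))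
                  (trans (cong (½ * ½ *_) (*-inverseʳ c)) (*-identityʳ _))

    0<½ : 0ℚ < ½
    0<½ = positive⁻¹ ½

    ½≤1 : ½ ≤ 1ℚ
    ½≤1 = ≤ᵇ⇒≤ _

    0<q : 0ℚ < q
    0<q = *-pos (*-pos 0<½ 0<½) (positive⁻¹ (1/ c) {{1/pos⇒pos c {{positive 0<c}}}})

    q≤1 : q ≤ 1ℚ
    q≤1 = begin
      q             ≡⟨ *-identityˡ q ⟨
      1ℚ * q        ≤⟨ *-monoʳ-≤-0≤ (<⇒≤ 0<q) (ℕ→ℚ-mono-≤ {1} {suc h} (s≤s z≤n)) ⟩
      c * q         ≡⟨ c*q≡¼ ⟩
      ½ * ½         ≤⟨ *-mono-≤-0≤ (<⇒≤ 0<½) (<⇒≤ 0<½) ½≤1 ½≤1 ⟩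
      1ℚ * 1ℚ       ≡⟨ *-identityˡ 1ℚ ⟩
      1ℚ            ∎
      where open ≤-Reasoning

  -- BadBound i (u r) holds for i + r ≤ h: the step from level i to i + 1 uses δ r, which is
  -- small enough that α + (h+1)(δ r + δ r) ≤ u r, and inherits the error u (suc r) = β δ_r^(h+1).
  u : ℕ → ℚ
  u zero    = β
  u (suc r) = β * (u r * q) ^ℚ suc h

  δ : ℕ → ℚ
  δ r = u r * q

  α : ℚ
  α = ½ * u h

  u-pos : ∀ r → 0ℚ < u r
  u-pos zero    = 0<β
  u-pos (suc r) = *-pos 0<β (^ℚ-pos (suc h) (*-pos (u-pos r) 0<q))

  δ-pos : ∀ r → 0ℚ < δ r
  δ-pos r = *-pos (u-pos r) 0<q

  δ≤u : ∀ r → δ r ≤ u r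
  δ≤u r = ≤-trans (*-monoˡ-≤-0≤ (<⇒≤ (u-pos r)) q≤1) (≤-reflexive (*-identityʳ (u r)))

  u≤1 : ∀ r → u r ≤ 1ℚ
  u-suc≤u : ∀ r → u (suc r) ≤ u r

  u≤1 zero    = β≤1
  u≤1 (suc r) = ≤-trans (u-suc≤u r) (u≤1 r)

  u-suc≤u r = begin
    β * δ r ^ℚ suc h     ≤⟨ *-monoʳ-≤-0≤ (^ℚ-nonNeg (suc h) (<⇒≤ (δ-pos r))) β≤1 ⟩
    1ℚ * δ r ^ℚ suc h    ≡⟨ *-identityˡ _ ⟩
    δ r ^ℚ suc h         ≤⟨ ^ℚ-≤-self {m = suc h} (<⇒≤ (δ-pos r)) (≤-trans (δ≤u r) (u≤1 r)) (s≤s z≤n) ⟩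
    δ r                  ≤⟨ δ≤u r ⟩
    u r                  ∎
    where open ≤-Reasoning

  δ≤1 : ∀ r → δ r ≤ 1ℚ
  δ≤1 r = ≤-trans (δ≤u r) (u≤1 r)

  u-antitone : ∀ {r r′} → r ℕ.≤ r′ → u r′ ≤ u r
  u-antitone {r} r≤r′ with ℕP.m≤n⇒∃[o]m+o≡n r≤r′
  ... | o , refl = go o
    where
    go : ∀ o → u (r ℕ.+ o) ≤ u r
    go zero    = ≤-reflexive (cong u (ℕP.+-identityʳ r))
    go (suc o) = ≤-trans (≤-reflexive (cong u (ℕP.+-suc r o))) (≤-trans (u-suc≤u (r ℕ.+ o)) (go o))

  α-pos : 0ℚ < α
  α-pos = *-pos 0<½ (u-pos h)

  α≤½u : ∀ {r} → r ℕ.≤ h → α ≤ ½ * u r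
  α≤½u r≤h = *-monoˡ-≤-0≤ (<⇒≤ 0<½) (u-antitone r≤h)

  α≤u : ∀ {r} → r ℕ.≤ h → α ≤ u r
  α≤u {r} r≤h = ≤-trans (α≤½u r≤h) (≤-trans (*-monoʳ-≤-0≤ (<⇒≤ (u-pos r)) ½≤1) (≤-reflexive (*-identityˡ _)))

  α≤1 : α ≤ 1ℚ
  α≤1 = ≤-trans (α≤u ℕP.≤-refl) (u≤1 h)

  α+[h+1][δ+δ]≤u : ∀ {r} → r ℕ.≤ h → α + ℕ→ℚ (suc h) * (δ r + δ r) ≤ u r
  α+[h+1][δ+δ]≤u {r} r≤h = begin
    α + c * (u r * q + u r * q)         ≤⟨ +-monoˡ-≤ (c * (δ r + δ r)) (α≤½u r≤h) ⟩
    ½ * u r + c * (u r * q + u r * q)   ≡⟨ cong (½ * u r +_) (solve 3 (λ c u q → c :* (u :* q :+ u :* q) := (u :+ u) :* (c :* q))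
                                                                 refl c (u r) q) ⟩
    ½ * u r + (u r + u r) * (c * q)     ≡⟨ cong (λ w → ½ * u r + (u r + u r) * w) c*q≡¼ ⟩
    ½ * u r + (u r + u r) * (½ * ½)     ≡⟨ solve 1 (λ u → con ½ :* u :+ (u :+ u) :* (con ½ :* con ½) := u) refl (u r) ⟩
    u r                                 ∎
    where open ≤-Reasoning

module Bounds (h : Data.Nat.ℕ) (β : Data.Rational.ℚ) (0<β : β Data.Rational.> Data.Rational.0ℚ)
              (β<1 : β Data.Rational.< Data.Rational.1ℚ) where
  open import Data.Nat as ℕ using (ℕ; zero; suc; z≤n; s≤s)
  import Data.Nat.Properties as ℕP
  open import Data.Bool using (Bool; true; false; not; _∨_; _∧_)
  open import Data.Bool.Properties using (∨-zeroʳ)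
  open import Data.Fin using (Fin; fromℕ<)
  open import Data.List using (List; length; replicate; upTo)
  open import Data.List.Properties using (length-replicate)
  open import Data.List.Membership.Propositional using (_∈_)
  open import Data.List.Membership.Propositional.Properties using (∈-allFin)
  open import Data.Product using (∃; _×_; _,_)
  open import Data.Sum using (_⊎_; [_,_]′)
  open import Data.Rational
  open import Data.Rational.Properties
  open import Relation.Binary.PropositionalEquality
  open import Data.Rational.Solver using (module +-*-Solver)
  open +-*-Solver using (solve; _:=_; _:+_; _:*_; _:-_; con)
  open import Defs using (Graph; ℕ→ℚ; _^ℚ_; twoE; nb; seqsOf; count)
  open Rationals
  open Constants β h 0<β (<⇒≤ β<1) public using (α; α-pos)
  open Constants β h 0<β (<⇒≤ β<1) using (u; δ; δ-pos; δ≤1; α≤u; α≤1; α+[h+1][δ+δ]≤u)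

  twoE-pos⇒n-pos : ∀ {n} (G : Graph n) → 1 ℕ.≤ twoE G → 1 ℕ.≤ n
  twoE-pos⇒n-pos {suc n} G _ = s≤s z≤n

  module _ {n : ℕ} (G : Graph n) where
    open Defs.Goodness G α β h
    open BadMoments G α β h
    open RationalSums using (Σ; pigeonhole; ℕ→ℚ-homo-Σ; Σ-boolFilter; Σ-+; Σ-cong)
    open Graphs G using (V; twoE≡0⇒nb∷≡0)
    open StarCount G using (Σ-nb-lower-bound)

    twoE-pos-or-zero : 1 ℕ.≤ twoE G ⊎ 0 ≡ twoE G
    twoE-pos-or-zero = ℕP.m≤n⇒m<n∨m≡n z≤n

    BadBound-u : 0ℚ < p → 0ℚ < nℚ → ∀ i r → i ℕ.+ r ℕ.≤ h → BadBound i (u r)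
    BadBound-u 0<p 0<n zero    r r≤h = BadBound-mono {0} (α≤u r≤h) (BadBound-zero (<⇒≤ α-pos) α≤1)
    BadBound-u 0<p 0<n (suc i) r i+r<h =
      BadBound-mono {suc i} (α+[h+1][δ+δ]≤u (ℕP.≤-trans (ℕP.m≤n+m r (suc i)) i+r<h))
        (Step.BadBound-suc (<⇒≤ α-pos) α≤1 0<β 0<p 0<n i {δ r} {u (suc r)} (δ-pos r) (δ≤1 r) ≤-refl
          (BadBound-u 0<p 0<n i (suc r) (subst (ℕ._≤ h) (sym (ℕP.+-suc i r)) i+r<h)))

    sumNb≡Σ-x : ∀ i j → ℕ→ℚ (sumNb i j) ≡ Σ x (A i j)
    sumNb≡Σ-x i j = trans (cong ℕ→ℚ (Counting.sum-map (nb G) (A i j))) (ℕ→ℚ-homo-Σ (nb G) (A i j))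

    sumNb+Bad≡Σ-x : ∀ i j → ℕ→ℚ (sumNb i j) + Bad i j 1 ≡ Σ x (seqsOf j V)
    sumNb+Bad≡Σ-x i j = begin
        ℕ→ℚ (sumNb i j) + Bad i j 1
      ≡⟨ cong (_+ Bad i j 1) (trans (sumNb≡Σ-x i j) (Σ-boolFilter x (good i) (seqsOf j V))) ⟩
        Σ (λ S → keepIf (good i S) (x S)) (seqsOf j V) + Bad i j 1
      ≡⟨ Σ-+ (λ S → keepIf (good i S) (x S)) (λ S → keepIf (not (good i S)) (x S ^ℚ 1)) (seqsOf j V) ⟨
        Σ (λ S → keepIf (good i S) (x S) + keepIf (not (good i S)) (x S ^ℚ 1)) (seqsOf j V)
      ≡⟨ Σ-cong (seqsOf j V) (λ S → split (good i S) (x S)) ⟩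
        Σ x (seqsOf j V)
      ∎
      where
      open ≡-Reasoning
      open RationalSums using (keepIf)
      split : ∀ b r → keepIf b r + keepIf (not b) (r ^ℚ 1) ≡ r
      split true  r = +-identityʳ r
      split false r = trans (+-identityˡ _) (^ℚ-identityʳ r)

    module Dense (1≤twoE : 1 ℕ.≤ twoE G) where
      0<n : 0ℚ < nℚ
      0<n = ℕ→ℚ-pos (twoE-pos⇒n-pos G 1≤twoE)

      0<p : 0ℚ < p
      0<p = ratioSq-pos 1≤twoE (twoE-pos⇒n-pos G 1≤twoE)

      sumNb-bound : ∀ i j → i ℕ.≤ h → suc j ℕ.≤ h →
        (1ℚ - β) * nℚ ^ℚ suc (suc j) * p ^ℚ suc j ≤ ℕ→ℚ (sumNb i (suc j))
      sumNb-bound i j i≤h j<h = begin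
          (1ℚ - β) * nℚ ^ℚ suc (suc j) * p ^ℚ suc j
        ≡⟨ solve 4 (λ β N Nʲ P → (con 1ℚ :- β) :* (N :* Nʲ) :* P
                                   := (N :* Nʲ) :* P :- β :* (Nʲ :* ((P :* N) :* con 1ℚ)))
                   refl β nℚ (nℚ ^ℚ suc j) (p ^ℚ suc j) ⟩
          nℚ ^ℚ suc (suc j) * p ^ℚ suc j - β * (nℚ ^ℚ suc j * s (suc j) ^ℚ 1)
        ≤⟨ +-mono-≤ (≤-trans (Σ-nb-lower-bound (twoE-pos⇒n-pos G 1≤twoE) j)
                            (≤-reflexive (ℕ→ℚ-homo-Σ (nb G) (seqsOf (suc j) V))))
                    (neg-antimono-≤ (BadBound-u 0<p 0<n i 0 (subst (ℕ._≤ h) (sym (ℕP.+-identityʳ i)) i≤h)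
                                       (suc j) 1 (s≤s z≤n) (s≤s z≤n) j<h)) ⟩
          Σ x (seqsOf (suc j) V) - Bad i (suc j) 1
        ≡⟨ cong (_- Bad i (suc j) 1) (sumNb+Bad≡Σ-x i (suc j)) ⟨
          ℕ→ℚ (sumNb i (suc j)) + Bad i (suc j) 1 - Bad i (suc j) 1
        ≡⟨ solve 2 (λ a b → a :+ b :- b := a) refl (ℕ→ℚ (sumNb i (suc j))) (Bad i (suc j) 1) ⟩
          ℕ→ℚ (sumNb i (suc j))
        ∎
        where open ≤-Reasoning

      good-witness : ∀ i j → i ℕ.≤ h → suc j ℕ.≤ h →
        ∃ λ S → S ∈ A i (suc j) × (1ℚ - β) * p ^ℚ suc j * nℚ ≤ x S
      good-witness i j i≤h j<h =
        pigeonhole x (A i (suc j)) 0<c (^ℚ-pos (suc j) 0<n) length-A≤ (begin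
          nℚ ^ℚ suc j * c
        ≡⟨ solve 4 (λ β N Nʲ P → Nʲ :* ((con 1ℚ :- β) :* P :* N) := (con 1ℚ :- β) :* (N :* Nʲ) :* P)
                   refl β nℚ (nℚ ^ℚ suc j) (p ^ℚ suc j) ⟩
          (1ℚ - β) * nℚ ^ℚ suc (suc j) * p ^ℚ suc j
        ≤⟨ sumNb-bound i j i≤h j<h ⟩
          ℕ→ℚ (sumNb i (suc j))
        ≡⟨ sumNb≡Σ-x i (suc j) ⟩
          Σ x (A i (suc j))
        ∎)
        where
        open ≤-Reasoning
        c : ℚ
        c = (1ℚ - β) * p ^ℚ suc j * nℚ
        0<c : 0ℚ < c
        0<c = *-pos (*-pos (p<q⇒0<q-p β<1) (^ℚ-pos (suc j) 0<p)) 0<n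
        length-A≤ : ℕ→ℚ (length (A i (suc j))) ≤ nℚ ^ℚ suc j
        length-A≤ = ≤-trans (ℕ→ℚ-mono-≤ (Counting.count-≤-length (good i) (seqsOf (suc j) V)))
                            (≤-reflexive (length-seqsOf-V (suc j)))

    module Sparse (twoE≡0 : twoE G ≡ 0) where
      p^suc≡0 : ∀ j → p ^ℚ suc j ≡ 0ℚ
      p^suc≡0 j = trans (cong (λ a → Defs.ratioSq a n ^ℚ suc j) twoE≡0)
                        (trans (cong (_^ℚ suc j) (ratioSq-zero n)) (^ℚ-zeroˡ j))

      sumNb-bound : ∀ i j → (1ℚ - β) * nℚ ^ℚ suc (suc j) * p ^ℚ suc j ≤ ℕ→ℚ (sumNb i (suc j))
      sumNb-bound i j = begin
        (1ℚ - β) * nℚ ^ℚ suc (suc j) * p ^ℚ suc j   ≡⟨ cong ((1ℚ - β) * nℚ ^ℚ suc (suc j) *_) (p^suc≡0 j) ⟩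
        (1ℚ - β) * nℚ ^ℚ suc (suc j) * 0ℚ           ≡⟨ *-zeroʳ ((1ℚ - β) * nℚ ^ℚ suc (suc j)) ⟩
        0ℚ                                          ≤⟨ ℕ→ℚ-nonNeg (sumNb i (suc j)) ⟩
        ℕ→ℚ (sumNb i (suc j))                       ∎
        where open ≤-Reasoning

      -- With p = 0 every threshold vanishes, so a sequence with no common neighbours is good.
      isolated-good : ∀ {S} j → length S ≡ suc j → suc j ℕ.≤ h → nb G S ≡ 0 → ∀ i → good i S ≡ true
      isolated-good {S} j length≡ j<h nb≡0 = good-S
        where
        zeroGood-S : zeroGood S ≡ true
        zeroGood-S = ≤⇒≤ᵇ≡true (begin
          α * p ^ℚ length S * nℚ     ≡⟨ cong (λ l → α * p ^ℚ l * nℚ) length≡ ⟩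
          α * p ^ℚ suc j * nℚ        ≡⟨ cong (λ w → α * w * nℚ) (p^suc≡0 j) ⟩
          α * 0ℚ * nℚ                ≡⟨ trans (cong (_* nℚ) (*-zeroʳ α)) (*-zeroˡ nℚ) ⟩
          0ℚ                         ≤⟨ ℕ→ℚ-nonNeg (nb G S) ⟩
          x S                        ∎)
          where open ≤-Reasoning
        good-S : ∀ i → good i S ≡ true
        good-S zero    = zeroGood-S
        good-S (suc i) = cong₂ _∧_ (Counting.≤⇒≤ᵇ≡true (subst (ℕ._≤ h) (sym length≡) j<h))
                           (cong₂ _∧_ zeroGood-S (Counting.allB-true (upTo (suc h)) requirement))
          where
          dense : ℕ → Bool
          dense k = (1ℚ - β) * (x S ^ℚ k) ≤ᵇ ℕ→ℚ (count (good i) (seqsOf k (Defs.N G S)))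
          requirement : ∀ k → not (length S ℕ.≤ᵇ k) ∨ dense k ≡ true
          requirement zero    = cong (λ l → not (l ℕ.≤ᵇ 0) ∨ dense 0) length≡
          requirement (suc k) = trans (cong (not (length S ℕ.≤ᵇ suc k) ∨_) (≤⇒≤ᵇ≡true (begin
            (1ℚ - β) * (x S ^ℚ suc k)          ≡⟨ cong (λ a → (1ℚ - β) * (ℕ→ℚ a ^ℚ suc k)) nb≡0 ⟩
            (1ℚ - β) * (0ℚ ^ℚ suc k)           ≡⟨ trans (cong ((1ℚ - β) *_) (^ℚ-zeroˡ k)) (*-zeroʳ (1ℚ - β)) ⟩
            0ℚ                                 ≤⟨ ℕ→ℚ-nonNeg (count (good i) (seqsOf (suc k) (Defs.N G S))) ⟩
            ℕ→ℚ (count (good i) (seqsOf (suc k) (Defs.N G S)))  ∎))) (∨-zeroʳ (not (length S ℕ.≤ᵇ suc k)))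
            where open ≤-Reasoning

      good-witness : 1 ℕ.≤ n → ∀ i j → suc j ℕ.≤ h →
        ∃ λ S → S ∈ A i (suc j) × (1ℚ - β) * p ^ℚ suc j * nℚ ≤ x S
      good-witness 1≤n i j j<h = S , S∈A , (begin
          (1ℚ - β) * p ^ℚ suc j * nℚ      ≡⟨ cong (λ w → (1ℚ - β) * w * nℚ) (p^suc≡0 j) ⟩
          (1ℚ - β) * 0ℚ * nℚ              ≡⟨ trans (cong (_* nℚ) (*-zeroʳ (1ℚ - β))) (*-zeroˡ nℚ) ⟩
          0ℚ                              ≤⟨ x-nonNeg S ⟩
          x S                             ∎)
        where
        open ≤-Reasoning
        v : Fin n
        v = fromℕ< 1≤n
        S : List (Fin n)
        S = replicate (suc j) v
        S∈A : S ∈ A i (suc j)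
        S∈A = Counting.∈-boolFilter (good i) (Counting.replicate-∈-seqsOf (suc j) (∈-allFin v))
                (isolated-good j (length-replicate (suc j)) j<h (twoE≡0⇒nb∷≡0 twoE≡0 v (replicate j v)) i)

    sumNb-bound : ∀ {i j} → i ℕ.≤ h → 1 ℕ.≤ j → j ℕ.≤ h → (1ℚ - β) * nℚ ^ℚ suc j * p ^ℚ j ≤ ℕ→ℚ (sumNb i j)
    sumNb-bound {i} {suc j} i≤h _ j<h = [ (λ 1≤twoE → Dense.sumNb-bound 1≤twoE i j i≤h j<h)
                                        , (λ 0≡twoE → Sparse.sumNb-bound (sym 0≡twoE) i j) ]′ twoE-pos-or-zero

    good-witness : ∀ {i j} → i ℕ.≤ h → 1 ℕ.≤ j → j ℕ.≤ h → 1 ℕ.≤ n →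
      ∃ λ S → S ∈ A i j × (1ℚ - β) * p ^ℚ j * nℚ ≤ x S
    good-witness {i} {suc j} i≤h _ j<h 1≤n = [ (λ 1≤twoE → Dense.good-witness 1≤twoE i j i≤h j<h)
                                             , (λ 0≡twoE → Sparse.good-witness (sym 0≡twoE) 1≤n i j j<h) ]′ twoE-pos-or-zero

open import Data.Nat using (ℕ; _≤_; suc)
open import Data.Fin using (Fin)
open import Data.List using (List)
open import Data.List.Membership.Propositional using (_∈_)
open import Data.Rational using (ℚ; 0ℚ; 1ℚ; _*_; _-_; _<_) renaming (_≤_ to _≤ℚ_)
open import Data.Product using (Σ; _×_; _,_)
open import Defs

theorem3p3 : (h : ℕ) → 1 ≤ h → (β : ℚ) → 0ℚ < β → β < 1ℚ →
    Σ ℚ (λ α → 0ℚ < α ×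
      ((n : ℕ) (G : Graph n) (i j : ℕ) → 1 ≤ i → i ≤ h → 1 ≤ j → j ≤ h →
        ((1ℚ - β) * (ℕ→ℚ n ^ℚ suc j)) * (density G ^ℚ j)
          ≤ℚ ℕ→ℚ (Goodness.sumNb G α β h i j)
        × (1 ≤ n →
           Σ (List (Fin n)) (λ S → S ∈ Goodness.A G α β h i j ×
             ((1ℚ - β) * (density G ^ℚ j)) * ℕ→ℚ n ≤ℚ ℕ→ℚ (nb G S)))))
-- The bounds also hold for i = 0, and 1 ≤ h already follows from 1 ≤ j ≤ h.
theorem3p3 h _ β 0<β β<1 =
  α , α-pos , λ n G i j _ i≤h 1≤j j≤h → sumNb-bound G i≤h 1≤j j≤h , good-witness G i≤h 1≤j j≤h
  where open Bounds h β 0<β β<1
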